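{- Let $T$ be a p-string over $\Sigma\cup\Pi$ whose last symbol is a sentinel $\$\in\Sigma$ occurring nowhere else in $T$, and let $P$ be a p-string. Consider the recursive procedure $\textsc{P-Match}(p,u)$, taking a pv-string $p$ and a node $u$ of $\mathsf{PLST}(T)$: (1) if $p=\varepsilon$, return $u$; (2) if $\mathsf{child}(u,p[1])$ is undefined, return null; (3) otherwise let $v=\mathsf{child}(u,p[1])$ and $l=\min\{|p|,|v|-|u|\}$; (a) if $l\ge2$ and $u$ or $v$ is bad, let $\alpha=\mathrm{str}(u,v)$ (recovered from the edge's triple label and $T'$); if $p[1:l]\ne\alpha[1:l]$ return null; (b) else if $l\ge2$: if $1\le\mathsf{Re}(v)\le|p|$, then if $p[\mathsf{Re}(v)]=|u|+\mathsf{Re}(v)-1$ set $p[\mathsf{Re}(v)]\leftarrow0$, otherwise return null; then if $\textsc{P-Match}(p[1:l],\mathsf{SL}(u))$ returns null, return null; (c) return $\textsc{P-Match}(p[l+1:],v)$. Then $T$ has a substring that p-matches $P$ if and only if $\textsc{P-Match}(\mathrm{pre}(P),\varepsilon)$ (called at the root) does not return null.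
   Context: $\Sigma$ (constant symbols) and $\Pi$ (parameter symbols) are disjoint alphabets of constant size; a p-string is a string over $\Sigma\cup\Pi$. Two p-strings $w_1,w_2$ of equal length p-match if there is a bijection $f$ on $\Sigma\cup\Pi$ with $f(a)=a$ for all $a\in\Sigma$ and $f(w_1[i])=w_2[i]$ for all $i$. For a string $w$: $|w|$ is its length, $w[i]$ its $i$-th symbol ($1$-indexed), $w[i:j]$ the substring from $i$ to $j$ ($=\varepsilon$ if $i>j$), $w[i:]=w[i:|w|]$. For strings $u$ and $uv$, $\mathrm{str}(u,uv)=v$. $\mathbb{N}$ denotes the non-negative integers. Prev-encoding: $\mathrm{pre}(w)$ has length $|w|$ with $\mathrm{pre}(w)[i]=w[i]$ if $w[i]\in\Sigma$; $=0$ if $w[i]\in\Pi$ does not occur in $w[1:i-1]$; $=i-k$ with $k=\max\{j<i:w[j]=w[i]\}$ otherwise. Strings over $\Sigma\cup\mathbb{N}$ are pv-strings. For a pv-string $u$ and $k\ge1$, $\langle u\rangle_k$ has length $|u|$, $\langle u\rangle_k[i]=0$ if $u[i]\in\mathbb{N}$ and $u[i]\ge i-k+1$, else $u[i]$; $\langle u\rangle=\langle u\rangle_1$; for nonempty $u$, $\mathsf{sl}(u)=\langle u[2:]\rangle$. $\mathsf{PrevSub}(T)=\{\mathrm{pre}(w): w\text{ a substring of }T\}$; $\mathsf{PSTrie}(T)$ is the trie on $\mathsf{PrevSub}(T)$ with root $\varepsilon$ and edges $u\to ua$. Type 1 nodes: leaves and branching nodes (at least two children) of $\mathsf{PSTrie}(T)$,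 including the root. Type 2 nodes: $u$ not Type 1 with $\mathsf{sl}(u)$ Type 1. $\mathsf{PLST}(T)$ has node set $V$ = Type 1 $\cup$ Type 2 nodes, and an edge $(u,uv)$ iff $v\ne\varepsilon$ and no proper nonempty prefix $v'$ of $v$ has $uv'\in V$; $\mathsf{child}(u,a)$ denotes the child $v$ of $u$ with $\mathrm{str}(u,v)[1]=a$. A node $u\in V$ is good if $u\neq\varepsilon$ and $\mathsf{sl}(u)\in V$, bad otherwise. For non-root $v$ with parent $u$, $\mathsf{Re}(v)=i-|u|$ if some (necessarily unique) $i$ with $|u|<i\le|v|$ has $v[i]=i-1$, else $0$. Each node $u$ stores $|u|$, $\mathsf{Re}(u)$, and, if good, a pointer $\mathsf{SL}(u)$ to node $\mathsf{sl}(u)$. Each edge $(u,v)$ stores a flag for whether $|v|-|u|=1$; if $|v|-|u|=1$ or both $u,v$ are good it stores only $\mathrm{str}(u,v)[1]$, otherwise a triple $(i,j,k)$ with $\mathrm{str}(u,v)=\langle T'\rangle_k[i:j]$ where $T'$ is a stored subsequence of $\mathrm{pre}(T)$. -}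

module Defs where

open import Data.Nat using (ℕ; zero; suc; _+_; _∸_; _≤_; _<_; _⊓_; _<ᵇ_; _≤ᵇ_; _≡ᵇ_)
open import Data.Fin using (Fin)
open import Data.Fin.Properties using () renaming (_≟_ to _≟F_)
open import Data.Sum using (_⊎_; inj₁; inj₂)
open import Data.Product using (Σ; ∃; _×_; _,_)
open import Data.List using (List; []; _∷_; _++_; length; take; drop; map)
open import Data.Maybe using (Maybe; just; nothing; maybe)
open import Data.Bool using (Bool; true; false; if_then_else_; _∧_)
open import Relation.Nullary using (¬_; does)
open import Relation.Binary.PropositionalEquality using (_≡_; _≢_)
open import Function.Bundles using (_⤖_; Bijection)

-- Alphabets: Σ = Fin σ (constant symbols), Π = Fin π (parameter symbols).
-- A p-string is a list over Σ ⊎ Π.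

Sym : ℕ → ℕ → Set
Sym σ π = Fin σ ⊎ Fin π

PVSym : ℕ → Set
PVSym σ = Fin σ ⊎ ℕ

PVStr : ℕ → Set
PVStr σ = List (PVSym σ)

IsSubstring : ∀ {A : Set} → List A → List A → Set
IsSubstring {A} w T = Σ (List A) λ x → Σ (List A) λ y → T ≡ x ++ (w ++ y)

PMatches : ∀ {σ π} → List (Sym σ π) → List (Sym σ π) → Set
PMatches {σ} {π} w₁ w₂ =
  length w₁ ≡ length w₂ ×
  Σ (Sym σ π ⤖ Sym σ π) λ f →
    (∀ (a : Fin σ) → Bijection.to f (inj₁ a) ≡ inj₁ a) ×
    map (Bijection.to f) w₁ ≡ w₂

-- Prev-encoding.
-- dist x r, where r is the reversed prefix w[i-1], w[i-2], ..., w[1]: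
-- just (i - k) for k the last position < i with w[k] = x, nothing if none.

dist : ∀ {σ π} → Fin π → List (Sym σ π) → Maybe ℕ
dist x [] = nothing
dist x (inj₁ _ ∷ r) = Data.Maybe.map suc (dist x r)
dist x (inj₂ y ∷ r) = if does (x ≟F y) then just 1 else Data.Maybe.map suc (dist x r)

preGo : ∀ {σ π} → List (Sym σ π) → List (Sym σ π) → PVStr σ
preGo rev [] = []
preGo rev (inj₁ a ∷ w) = inj₁ a ∷ preGo (inj₁ a ∷ rev) w
preGo rev (inj₂ x ∷ w) = inj₂ (maybe (λ n → n) 0 (dist x rev)) ∷ preGo (inj₂ x ∷ rev) w

pre : ∀ {σ π} → List (Sym σ π) → PVStr σ
pre w = preGo [] w

-- ⟨u⟩_k : position i (1-indexed) holding n ∈ ℕ becomes 0 iff n ≥ i - k + 1,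
-- i.e. iff i < n + k.

angleGo : ∀ {σ} → ℕ → ℕ → PVStr σ → PVStr σ
angleGo k i [] = []
angleGo k i (inj₁ a ∷ u) = inj₁ a ∷ angleGo k (suc i) u
angleGo k i (inj₂ n ∷ u) = inj₂ (if i <ᵇ n + k then 0 else n) ∷ angleGo k (suc i) u

angle : ∀ {σ} → ℕ → PVStr σ → PVStr σ
angle k u = angleGo k 1 u

-- sl(u) = ⟨u[2:]⟩ (only meaningful for nonempty u; sl ε := ε is never used
-- on a meaningful path since the root is bad).
sl : ∀ {σ} → PVStr σ → PVStr σ
sl [] = []
sl (_ ∷ u) = angle 1 u

str : ∀ {A : Set} → List A → List A → List A
str u v = drop (length u) v

-- 1-indexed access and update
at : ∀ {A : Set} → ℕ → List A → Maybe A
at _ [] = nothing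
at zero (_ ∷ _) = nothing
at (suc zero) (a ∷ _) = just a
at (suc (suc i)) (_ ∷ w) = at (suc i) w

setAt : ∀ {A : Set} → ℕ → A → List A → List A
setAt _ b [] = []
setAt zero b w = w
setAt (suc zero) b (_ ∷ w) = b ∷ w
setAt (suc (suc i)) b (a ∷ w) = a ∷ setAt (suc i) b w

module PLST {σ π : ℕ} (T : List (Sym σ π)) where

  PrevSub : PVStr σ → Set
  PrevSub p = Σ (List (Sym σ π)) λ w → IsSubstring w T × pre w ≡ p

  -- nodes of PSTrie(T) are elements of PrevSub(T); children of u are u ++ [a]
  IsLeaf : PVStr σ → Set
  IsLeaf u = ∀ a → ¬ PrevSub (u ++ (a ∷ []))

  IsBranching : PVStr σ → Set
  IsBranching u = Σ (PVSym σ) λ a → Σ (PVSym σ) λ b →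
    a ≢ b × PrevSub (u ++ (a ∷ [])) × PrevSub (u ++ (b ∷ []))

  Type1 : PVStr σ → Set
  Type1 u = PrevSub u × (u ≡ [] ⊎ IsLeaf u ⊎ IsBranching u)

  Type2 : PVStr σ → Set
  Type2 u = PrevSub u × ¬ Type1 u × Type1 (sl u)

  V : PVStr σ → Set
  V u = Type1 u ⊎ Type2 u

  Edge : PVStr σ → PVStr σ → Set
  Edge u w = V u × V w × Σ (PVStr σ) λ v →
    w ≡ u ++ v × v ≢ [] ×
    (∀ v′ v″ → v ≡ v′ ++ v″ → v′ ≢ [] → v″ ≢ [] → ¬ V (u ++ v′))

  IsChild : PVStr σ → PVSym σ → PVStr σ → Set
  IsChild u a w = Edge u w × Σ (PVStr σ) λ v′ → str u w ≡ a ∷ v′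

  Good : PVStr σ → Set
  Good u = u ≢ [] × V (sl u)

  -- Re(w) for w with parent u: the offset j = i - |u| ≥ 1 of the (unique)
  -- position i, |u| < i ≤ |w|, with w[i] = i - 1; 0 if none.
  reGo : ℕ → ℕ → PVStr σ → ℕ
  reGo base j [] = 0
  reGo base j (inj₁ _ ∷ r) = reGo base (suc j) r
  reGo base j (inj₂ n ∷ r) = if n ≡ᵇ (base + j ∸ 1) then j else reGo base (suc j) r

  Re : PVStr σ → PVStr σ → ℕ
  Re u w = reGo (length u) 1 (str u w)

  ell : PVStr σ → PVStr σ → PVStr σ → ℕ
  ell u v p = length p ⊓ (length v ∸ length u)

  ReOK : PVStr σ → PVStr σ → PVStr σ → Set
  ReOK u v p = 1 ≤ Re u v → Re u v ≤ length p →
    at (Re u v) p ≡ just (inj₂ (length u + Re u v ∸ 1))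

  upd : PVStr σ → PVStr σ → PVStr σ → PVStr σ
  upd u v p = if (1 ≤ᵇ Re u v) ∧ (Re u v ≤ᵇ length p)
              then setAt (Re u v) (inj₂ 0) p else p

  -- Big-step semantics of P-Match: Run p u r  means
  -- P-Match(p, u) terminates and returns r (nothing = null).
  data Run : PVStr σ → PVStr σ → Maybe (PVStr σ) → Set where
    r-empty : ∀ {u} → Run [] u (just u)
    r-nochild : ∀ {a p u} → (∀ v → ¬ IsChild u a v) → Run (a ∷ p) u nothing
    r-short : ∀ {a p u v r} → IsChild u a v →
      ell u v (a ∷ p) < 2 →
      Run (drop (ell u v (a ∷ p)) (a ∷ p)) v r →
      Run (a ∷ p) u r
    r-bad-fail : ∀ {a p u v} → IsChild u a v →
      2 ≤ ell u v (a ∷ p) → ¬ (Good u × Good v) →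
      take (ell u v (a ∷ p)) (a ∷ p) ≢ take (ell u v (a ∷ p)) (str u v) →
      Run (a ∷ p) u nothing
    r-bad-ok : ∀ {a p u v r} → IsChild u a v →
      2 ≤ ell u v (a ∷ p) → ¬ (Good u × Good v) →
      take (ell u v (a ∷ p)) (a ∷ p) ≡ take (ell u v (a ∷ p)) (str u v) →
      Run (drop (ell u v (a ∷ p)) (a ∷ p)) v r →
      Run (a ∷ p) u r
    r-re-fail : ∀ {a p u v} → IsChild u a v →
      2 ≤ ell u v (a ∷ p) → Good u × Good v →
      ¬ ReOK u v (a ∷ p) →
      Run (a ∷ p) u nothing
    r-sl-fail : ∀ {a p u v} → IsChild u a v →
      2 ≤ ell u v (a ∷ p) → Good u × Good v →
      ReOK u v (a ∷ p) →
      Run (take (ell u v (a ∷ p)) (upd u v (a ∷ p))) (sl u) nothing →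
      Run (a ∷ p) u nothing
    r-sl-ok : ∀ {a p u v w r} → IsChild u a v →
      2 ≤ ell u v (a ∷ p) → Good u × Good v →
      ReOK u v (a ∷ p) →
      Run (take (ell u v (a ∷ p)) (upd u v (a ∷ p))) (sl u) (just w) →
      Run (drop (ell u v (a ∷ p)) (upd u v (a ∷ p))) v r →
      Run (a ∷ p) u r

module Submission where

-- Substrings of T p-match P exactly when their prev-encodings agree, so the claim is that P-Match
-- accepts pre P iff pre P ∈ PrevSub(T). Soundness reads a successful run backwards: each step follows
-- an edge (u, v) of PLST(T) as far as the pattern goes. In step (b) only the suffix-link call certifies
-- the pattern, against ⟨str(u, v)⟩ below sl u; since the path below sl u is unary as well, that call
-- plus the Re-check pins the pattern down to str(u, v) itself. Completeness is by induction on
-- |p|·(|T| + 1) + |u|: the sentinel makes the encoding of every suffix of T a leaf, so each node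
-- consistent with the pattern has the required child, and along a unary edge the first symbol already
-- determines the match, which is then transported to sl u.

open import Defs
open import Data.Nat using (ℕ)
open import Data.Fin using (Fin)
open import Data.Sum using (inj₁)
open import Data.Product using (Σ; _×_)
open import Data.List using (List; []; _∷_; _++_)
open import Data.List.Membership.Propositional using (_∉_)
open import Data.Maybe using (just)
open import Function.Bundles using (_⇔_)

open import Data.Bool using (Bool; true; false; if_then_else_; _∧_)
import Data.Bool as Bool
open import Data.Empty using (⊥; ⊥-elim)
open import Data.Fin.Properties using () renaming (_≟_ to _≟F_)
open import Data.List using (length; take; drop; map; reverse)
open import Data.List.Properties
  using (∷-injectiveˡ; ∷-injectiveʳ; ++-assoc; ++-identityʳ; ++-cancelˡ; length-++; length-take;
         length-drop; take-take; take++drop≡id; take-all; drop-all; unfold-reverse; reverse-++;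
         length-reverse)
import Data.List.Properties as List
open import Data.List.Membership.Propositional using (_∈_)
open import Data.List.Relation.Unary.Any using (here; there)
open import Data.Maybe using (Maybe; nothing; maybe)
import Data.Maybe as Maybe
open import Data.Maybe.Properties using (just-injective)
open import Data.Nat using (zero; suc; _+_; _*_; _∸_; _≤_; _<_; _⊓_; _<ᵇ_; _≤ᵇ_; _≡ᵇ_; z≤n; s≤s; _<?_)
open import Data.Nat.Properties
open import Data.Product using (∃; _,_; proj₁; proj₂)
open import Data.Sum using (_⊎_; inj₂)
open import Data.Sum.Properties using (inj₂-injective)
import Data.Sum.Properties as Sum
open import Data.Unit using (tt)
open import Function.Bundles using (_⤖_; Bijection; mk⤖; mk⇔)
open import Relation.Binary using (tri<; tri≈; tri>)
open import Relation.Binary.PropositionalEquality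
open import Relation.Nullary using (¬_; Dec; yes; no)
open import Relation.Nullary.Decidable using (map′; ¬?; _×-dec_; _⊎-dec_; dec-true; dec-false)
open import Data.Fin.Permutation using (Permutation′; _⟨$⟩ʳ_; _⟨$⟩ˡ_; inverseˡ; inverseʳ; transpose; _∘ₚ_)
import Data.Fin.Permutation as Permutation

true⇒T : {b : Bool} → b ≡ true → Bool.T b
true⇒T refl = tt

false⇒¬T : {b : Bool} → b ≡ false → ¬ Bool.T b
false⇒¬T refl ()

module _ {A : Set} where

  take-length-++ : (x y : List A) → take (length x) (x ++ y) ≡ x
  take-length-++ [] y = refl
  take-length-++ (a ∷ x) y = cong (a ∷_) (take-length-++ x y)

  drop-length-++ : (x y : List A) → drop (length x) (x ++ y) ≡ y
  drop-length-++ [] y = refl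
  drop-length-++ (a ∷ x) y = drop-length-++ x y

  take-length+-++ : (x y : List A) (k : ℕ) → take (length x + k) (x ++ y) ≡ x ++ take k y
  take-length+-++ [] y k = refl
  take-length+-++ (a ∷ x) y k = cong (a ∷_) (take-length+-++ x y k)

  drop-++-≤ : (i : ℕ) (x y : List A) → i ≤ length x → drop i (x ++ y) ≡ drop i x ++ y
  drop-++-≤ zero x y h = refl
  drop-++-≤ (suc i) (a ∷ x) y (s≤s h) = drop-++-≤ i x y h

  length-take-≤ : (k : ℕ) (x : List A) → k ≤ length x → length (take k x) ≡ k
  length-take-≤ k x h = trans (length-take k x) (m≤n⇒m⊓n≡m h)

  take-take-≤ : (k m : ℕ) (x : List A) → k ≤ m → take k (take m x) ≡ take k x
  take-take-≤ k m x h = trans (take-take k m x) (cong (λ n → take n x) (m≤n⇒m⊓n≡m h))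

  take-length : (x : List A) → take (length x) x ≡ x
  take-length x = take-all (length x) x ≤-refl

  nonempty⇒1≤length : (x : List A) → x ≢ [] → 1 ≤ length x
  nonempty⇒1≤length [] h = ⊥-elim (h refl)
  nonempty⇒1≤length (_ ∷ _) h = s≤s z≤n

  take-nonempty : (k : ℕ) (x : List A) → 1 ≤ k → x ≢ [] → take k x ≢ []
  take-nonempty (suc k) [] h ne e = ne refl
  take-nonempty (suc k) (a ∷ x) h ne ()

  drop-nonempty : (k : ℕ) (x : List A) → k < length x → drop k x ≢ []
  drop-nonempty zero (a ∷ x) h ()
  drop-nonempty (suc k) (a ∷ x) (s≤s h) = drop-nonempty k x h

  at-take : (j k : ℕ) (x : List A) → j ≤ k → at j (take k x) ≡ at j x
  at-take zero zero [] h = refl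
  at-take zero zero (a ∷ x) h = refl
  at-take zero (suc k) [] h = refl
  at-take zero (suc k) (a ∷ x) h = refl
  at-take (suc zero) (suc k) [] h = refl
  at-take (suc zero) (suc k) (a ∷ x) h = refl
  at-take (suc (suc j)) (suc k) [] h = refl
  at-take (suc (suc j)) (suc k) (a ∷ x) (s≤s h) = at-take (suc j) k x h

  at-++ʳ : (u x : List A) (j : ℕ) → at (length u + suc j) (u ++ x) ≡ at (suc j) x
  at-++ʳ [] x j = refl
  at-++ʳ (a ∷ []) x j = refl
  at-++ʳ (a ∷ b ∷ u) x j = at-++ʳ (b ∷ u) x j

  at-++ˡ : (j : ℕ) (x y : List A) → j ≤ length x → at j (x ++ y) ≡ at j x
  at-++ˡ j x y h = trans (sym (at-take j (length x) (x ++ y) h)) (cong (at j) (take-length-++ x y))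

  at⇒< : (j : ℕ) (x : List A) {z : A} → at (suc j) x ≡ just z → j < length x
  at⇒< zero (a ∷ x) e = s≤s z≤n
  at⇒< (suc j) (a ∷ x) e = s≤s (at⇒< j x e)

  at-map : {B : Set} (f : A → B) (k : ℕ) (x : List A) → at k (map f x) ≡ Maybe.map f (at k x)
  at-map f k [] = refl
  at-map f zero (a ∷ x) = refl
  at-map f (suc zero) (a ∷ x) = refl
  at-map f (suc (suc k)) (a ∷ x) = at-map f (suc k) x

  at-split : (j : ℕ) (x : List A) {z : A} → at (suc j) x ≡ just z →
    Σ (List A) λ q → Σ (List A) λ q′ → x ≡ q ++ (z ∷ q′) × length q ≡ j
  at-split zero (a ∷ x) refl = [] , x , refl , refl
  at-split (suc j) (a ∷ x) e with at-split j x e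
  ... | q , q′ , refl , refl = a ∷ q , q′ , refl , refl

  take-≡-pointwise : (l : ℕ) (x y : List A) → l ≤ length x → l ≤ length y →
    (∀ j → j < l → at (suc j) x ≡ at (suc j) y) → take l x ≡ take l y
  take-≡-pointwise zero x y h₁ h₂ f = refl
  take-≡-pointwise (suc l) (a ∷ x) (b ∷ y) (s≤s h₁) (s≤s h₂) f =
    cong₂ _∷_ (just-injective (f 0 (s≤s z≤n)))
              (take-≡-pointwise l x y h₁ h₂ (λ j lt → f (suc j) (s≤s lt)))

  take-≡⇒at-≡ : (l : ℕ) (x y : List A) → take l x ≡ take l y → ∀ j → j < l → at (suc j) x ≡ at (suc j) y
  take-≡⇒at-≡ l x y e j lt =
    trans (sym (at-take (suc j) l x lt)) (trans (cong (at (suc j)) e) (at-take (suc j) l y lt))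

  length-setAt : (i : ℕ) (c : A) (x : List A) → length (setAt i c x) ≡ length x
  length-setAt i c [] = refl
  length-setAt zero c (a ∷ x) = refl
  length-setAt (suc zero) c (a ∷ x) = refl
  length-setAt (suc (suc i)) c (a ∷ x) = cong suc (length-setAt (suc i) c x)

  at-setAt-≢ : (j t : ℕ) (c : A) (x : List A) → j ≢ t → at (suc j) (setAt (suc t) c x) ≡ at (suc j) x
  at-setAt-≢ j t c [] ne = refl
  at-setAt-≢ zero zero c (a ∷ x) ne = ⊥-elim (ne refl)
  at-setAt-≢ zero (suc t) c (a ∷ x) ne = refl
  at-setAt-≢ (suc j) zero c (a ∷ x) ne = refl
  at-setAt-≢ (suc j) (suc t) c (a ∷ x) ne = at-setAt-≢ j t c x (λ e → ne (cong suc e))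

  at-setAt-≡ : (t : ℕ) (c : A) (x : List A) → t < length x → at (suc t) (setAt (suc t) c x) ≡ just c
  at-setAt-≡ zero c (a ∷ x) lt = refl
  at-setAt-≡ (suc t) c (a ∷ x) (s≤s lt) = at-setAt-≡ t c x lt

  drop-setAt : (l t : ℕ) (c : A) (x : List A) → t < l → drop l (setAt (suc t) c x) ≡ drop l x
  drop-setAt l t c [] lt = refl
  drop-setAt (suc l) zero c (a ∷ x) lt = refl
  drop-setAt (suc l) (suc t) c (a ∷ x) (s≤s lt) = drop-setAt l t c x lt

module _ {σ π : ℕ} where

  dist-bounds : (y : Fin π) (r : List (Sym σ π)) {m : ℕ} → dist y r ≡ just m → 1 ≤ m × m ≤ length r
  dist-bounds y [] ()
  dist-bounds y (inj₁ a ∷ r) e with dist y r in eq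
  ... | just k with e
  ... | refl = let (h₁ , h₂) = dist-bounds y r eq in ≤-trans h₁ (n≤1+n _) , s≤s h₂
  dist-bounds y (inj₂ z ∷ r) e with y ≟F z
  ... | yes _ with e
  ... | refl = s≤s z≤n , s≤s z≤n
  dist-bounds y (inj₂ z ∷ r) e | no _ with dist y r in eq
  ... | just k with e
  ... | refl = let (h₁ , h₂) = dist-bounds y r eq in ≤-trans h₁ (n≤1+n _) , s≤s h₂

  dist-∷ʳ-just : (y : Fin π) (r : List (Sym σ π)) (z : Sym σ π) {m : ℕ} →
    dist y r ≡ just m → dist y (r ++ (z ∷ [])) ≡ just m
  dist-∷ʳ-just y [] z ()
  dist-∷ʳ-just y (inj₁ a ∷ r) z e with dist y r in eq
  ... | just k with e
  ... | refl rewrite dist-∷ʳ-just y r z eq = refl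
  dist-∷ʳ-just y (inj₂ w ∷ r) z e with y ≟F w
  ... | yes _ = e
  ... | no _ with dist y r in eq
  ... | just k with e
  ... | refl rewrite dist-∷ʳ-just y r z eq = refl

  dist-∷ʳ-self : (y : Fin π) (r : List (Sym σ π)) →
    dist y r ≡ nothing → dist y (r ++ (inj₂ y ∷ [])) ≡ just (suc (length r))
  dist-∷ʳ-self y [] e with y ≟F y
  ... | yes _ = refl
  ... | no ne = ⊥-elim (ne refl)
  dist-∷ʳ-self y (inj₁ a ∷ r) e with dist y r in eq
  ... | nothing rewrite dist-∷ʳ-self y r eq = refl
  dist-∷ʳ-self y (inj₂ w ∷ r) e with y ≟F w
  dist-∷ʳ-self y (inj₂ w ∷ r) () | yes _
  ... | no _ with dist y r in eq
  ... | nothing rewrite dist-∷ʳ-self y r eq = refl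

  dist-∷ʳ-nothing : (y : Fin π) (r : List (Sym σ π)) (z : Sym σ π) →
    dist y r ≡ nothing → z ≢ inj₂ y → dist y (r ++ (z ∷ [])) ≡ nothing
  dist-∷ʳ-nothing y [] (inj₁ a) e ne = refl
  dist-∷ʳ-nothing y [] (inj₂ w) e ne with y ≟F w
  ... | yes refl = ⊥-elim (ne refl)
  ... | no _ = refl
  dist-∷ʳ-nothing y (inj₁ a ∷ r) z e ne with dist y r in eq
  ... | nothing rewrite dist-∷ʳ-nothing y r z eq ne = refl
  dist-∷ʳ-nothing y (inj₂ w ∷ r) z e ne with y ≟F w
  dist-∷ʳ-nothing y (inj₂ w ∷ r) z () ne | yes _
  ... | no _ with dist y r in eq
  ... | nothing rewrite dist-∷ʳ-nothing y r z eq ne = refl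

  dist-≤-occurrence : (y : Fin π) (q q′ : List (Sym σ π)) {m : ℕ} →
    dist y (q ++ inj₂ y ∷ q′) ≡ just m → m ≤ suc (length q)
  dist-≤-occurrence y [] q′ e with y ≟F y
  dist-≤-occurrence y [] q′ refl | yes _ = s≤s z≤n
  ... | no ne = ⊥-elim (ne refl)
  dist-≤-occurrence y (inj₁ a ∷ q) q′ e with dist y (q ++ inj₂ y ∷ q′) in eq
  ... | just k with e
  ... | refl = s≤s (dist-≤-occurrence y q q′ eq)
  dist-≤-occurrence y (inj₂ a ∷ q) q′ e with y ≟F a
  dist-≤-occurrence y (inj₂ a ∷ q) q′ refl | yes _ = s≤s z≤n
  ... | no _ with dist y (q ++ inj₂ y ∷ q′) in eq
  ... | just k with e
  ... | refl = s≤s (dist-≤-occurrence y q q′ eq)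

  dist-maximal⇒last : (y : Fin π) (q : List (Sym σ π)) (z : Sym σ π) →
    dist y (q ++ z ∷ []) ≡ just (suc (length q)) → z ≡ inj₂ y
  dist-maximal⇒last y [] (inj₂ a) e with y ≟F a
  ... | yes refl = refl
  dist-maximal⇒last y [] (inj₂ a) () | no _
  dist-maximal⇒last y (inj₁ b ∷ q) z e with dist y (q ++ z ∷ []) in eq
  ... | just k with e
  ... | refl = dist-maximal⇒last y q z eq
  dist-maximal⇒last y (inj₂ b ∷ q) z e with y ≟F b
  dist-maximal⇒last y (inj₂ b ∷ []) z () | yes _
  dist-maximal⇒last y (inj₂ b ∷ x ∷ q) z () | yes _
  ... | no _ with dist y (q ++ z ∷ []) in eq
  ... | just k with e
  ... | refl = dist-maximal⇒last y q z eq

  -- Appending x to the history r changes only the references that reach x, and ⟨·⟩ resets exactly those.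
  angleGo-preGo-∷ʳ : (r : List (Sym σ π)) (x : Sym σ π) (w : List (Sym σ π)) →
    angleGo 1 (suc (length r)) (preGo (r ++ (x ∷ [])) w) ≡ preGo r w
  angleGo-preGo-∷ʳ r x [] = refl
  angleGo-preGo-∷ʳ r x (inj₁ a ∷ w) = cong (inj₁ a ∷_) (angleGo-preGo-∷ʳ (inj₁ a ∷ r) x w)
  angleGo-preGo-∷ʳ r x (inj₂ y ∷ w) = cong₂ _∷_ (cong inj₂ head) (angleGo-preGo-∷ʳ (inj₂ y ∷ r) x w)
    where
    n = suc (length r)
    head : (if n <ᵇ maybe (λ k → k) 0 (dist y (r ++ (x ∷ []))) + 1 then 0
            else maybe (λ k → k) 0 (dist y (r ++ (x ∷ [])))) ≡ maybe (λ k → k) 0 (dist y r)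
    head with dist y r in eq
    ... | just m rewrite dist-∷ʳ-just y r x eq with dist-bounds y r eq
    ... | (_ , m≤) with n <ᵇ m + 1 in lt
    ... | false = refl
    ... | true = ⊥-elim (<⇒≱ (<ᵇ⇒< n (m + 1) (true⇒T lt)) (subst (_≤ n) (+-comm 1 m) (s≤s m≤)))
    head | nothing with Sum.≡-dec _≟F_ _≟F_ x (inj₂ y)
    ... | yes refl rewrite dist-∷ʳ-self y r eq with n <ᵇ n + 1 in lt
    ... | true = refl
    ... | false = ⊥-elim (false⇒¬T lt (<⇒<ᵇ (subst (n <_) (+-comm 1 n) ≤-refl)))
    head | nothing | no ne rewrite dist-∷ʳ-nothing y r x eq ne = refl

  sl-pre : (x : Sym σ π) (w : List (Sym σ π)) → sl (pre (x ∷ w)) ≡ pre w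
  sl-pre (inj₁ a) w = angleGo-preGo-∷ʳ [] (inj₁ a) w
  sl-pre (inj₂ a) w = angleGo-preGo-∷ʳ [] (inj₂ a) w

  length-preGo : (r w : List (Sym σ π)) → length (preGo r w) ≡ length w
  length-preGo r [] = refl
  length-preGo r (inj₁ a ∷ w) = cong suc (length-preGo _ w)
  length-preGo r (inj₂ a ∷ w) = cong suc (length-preGo _ w)

  take-preGo : (k : ℕ) (r w : List (Sym σ π)) → take k (preGo r w) ≡ preGo r (take k w)
  take-preGo zero r w = refl
  take-preGo (suc k) r [] = refl
  take-preGo (suc k) r (inj₁ a ∷ w) = cong (inj₁ a ∷_) (take-preGo k _ w)
  take-preGo (suc k) r (inj₂ a ∷ w) = cong (_ ∷_) (take-preGo k _ w)

  encode : List (Sym σ π) → Sym σ π → PVSym σ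
  encode rev (inj₁ a) = inj₁ a
  encode rev (inj₂ y) = inj₂ (maybe (λ n → n) 0 (dist y rev))

  at-preGo : (k : ℕ) (r w : List (Sym σ π)) →
    at (suc k) (preGo r w) ≡ Maybe.map (encode (reverse (take k w) ++ r)) (at (suc k) w)
  at-preGo k r [] = refl
  at-preGo zero r (inj₁ a ∷ w) = refl
  at-preGo zero r (inj₂ a ∷ w) = refl
  at-preGo (suc k) r (x ∷ w) = trans (shift x) (cong (λ q → Maybe.map (encode q) (at (suc k) w)) reorder)
    where
    reorder : reverse (take k w) ++ x ∷ r ≡ reverse (take (suc k) (x ∷ w)) ++ r
    reorder = trans (sym (++-assoc (reverse (take k w)) (x ∷ []) r))
                    (cong (_++ r) (sym (unfold-reverse x (take k w))))
    shift : (x : Sym σ π) →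
      at (suc (suc k)) (preGo r (x ∷ w)) ≡ Maybe.map (encode (reverse (take k w) ++ x ∷ r)) (at (suc k) w)
    shift (inj₁ a) = at-preGo k (inj₁ a ∷ r) w
    shift (inj₂ a) = at-preGo k (inj₂ a ∷ r) w

  pre-at-const : (k : ℕ) (w : List (Sym σ π)) {c : Fin σ} →
    at (suc k) (pre w) ≡ just (inj₁ c) → at (suc k) w ≡ just (inj₁ c)
  pre-at-const k w e rewrite at-preGo k [] w with at (suc k) w
  pre-at-const k w refl | just (inj₁ a) = refl
  pre-at-const k w () | just (inj₂ y)
  pre-at-const k w () | nothing

  pre-at-≤ : (k : ℕ) (w : List (Sym σ π)) {n : ℕ} → at (suc k) (pre w) ≡ just (inj₂ n) → n ≤ k
  pre-at-≤ k w e rewrite at-preGo k [] w with at (suc k) w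
  pre-at-≤ k w () | just (inj₁ a)
  ... | just (inj₂ y) with dist y (reverse (take k w) ++ []) in eq | e
  ... | nothing | refl = z≤n
  ... | just m | refl = begin
    m                                 ≤⟨ proj₂ (dist-bounds y (reverse (take k w) ++ []) eq) ⟩
    length (reverse (take k w) ++ []) ≡⟨ cong length (++-identityʳ (reverse (take k w))) ⟩
    length (reverse (take k w))       ≡⟨ length-reverse (take k w) ⟩
    length (take k w)                 ≡⟨ length-take k w ⟩
    k ⊓ length w                      ≤⟨ m⊓n≤m k (length w) ⟩
    k                                 ∎
    where open ≤-Reasoning

  pre-at⇒dist : (k : ℕ) (w : List (Sym σ π)) {n : ℕ} → at (suc k) (pre w) ≡ just (inj₂ (suc n)) →
    Σ (Fin π) λ y → at (suc k) w ≡ just (inj₂ y) × dist y (reverse (take k w) ++ []) ≡ just (suc n)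
  pre-at⇒dist k w e rewrite at-preGo k [] w with at (suc k) w
  pre-at⇒dist k w () | just (inj₁ a)
  ... | just (inj₂ y) with dist y (reverse (take k w) ++ []) in eq | e
  ... | just m | refl = y , refl , eq

  dist-reaches-head : (k : ℕ) (w : List (Sym σ π)) (y : Fin π) → at (suc (suc k)) w ≡ just (inj₂ y) →
    dist y (reverse (take (suc k) w) ++ []) ≡ just (suc k) → Σ (List (Sym σ π)) λ w₁ → w ≡ inj₂ y ∷ w₁
  dist-reaches-head k (x ∷ w₁) y at₂ d = w₁ , cong (_∷ w₁) (dist-maximal⇒last y q x d′)
    where
    q = reverse (take k w₁)
    length-q : length q ≡ k
    length-q = trans (length-reverse (take k w₁)) (length-take-≤ k w₁ (<⇒≤ (at⇒< k w₁ at₂)))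
    d′ : dist y (q ++ x ∷ []) ≡ just (suc (length q))
    d′ = begin
      dist y (q ++ x ∷ [])                        ≡⟨ cong (dist y) (sym (++-identityʳ (q ++ x ∷ []))) ⟩
      dist y ((q ++ x ∷ []) ++ [])                ≡⟨ cong (λ t → dist y (t ++ [])) (sym (unfold-reverse x (take k w₁))) ⟩
      dist y (reverse (take (suc k) (x ∷ w₁)) ++ []) ≡⟨ d ⟩
      just (suc k)                                ≡⟨ cong (λ t → just (suc t)) (sym length-q) ⟩
      just (suc (length q))                       ∎
      where open ≡-Reasoning

  -- Two positions of pre w cannot both point back to w[1]: the later one would point to the earlier.
  pre-head-referenced-once : (k k′ : ℕ) (w : List (Sym σ π)) → suc k < k′ →
    at (suc (suc k)) (pre w) ≡ just (inj₂ (suc k)) → at (suc k′) (pre w) ≡ just (inj₂ k′) → ⊥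
  pre-head-referenced-once k (suc k′) w lt e₁ e₂
    with pre-at⇒dist (suc k) w e₁ | pre-at⇒dist (suc k′) w e₂
  ... | y , a₁ , d₁ | y′ , a₂ , d₂ with dist-reaches-head k w y a₁ d₁ | dist-reaches-head k′ w y′ a₂ d₂
  ... | w₁ , refl | w₂ , refl
    with at-split (suc k) (take (suc k′) (inj₂ y ∷ w₁))
                  (trans (at-take (suc (suc k)) (suc k′) (inj₂ y ∷ w₁) lt) a₁)
  ... | q , q′ , split , length-q = <-irrefl refl q′<q′
    where
    prefix = take (suc k′) (inj₂ y ∷ w₁)
    length-prefix : length prefix ≡ suc k′
    length-prefix = length-take-≤ (suc k′) (inj₂ y ∷ w₁) (<⇒≤ (at⇒< (suc k′) (inj₂ y ∷ w₁) a₂))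
    reversed : reverse prefix ++ [] ≡ reverse q′ ++ inj₂ y ∷ (reverse q ++ [])
    reversed = begin
      reverse prefix ++ []                          ≡⟨ cong (λ t → reverse t ++ []) split ⟩
      reverse (q ++ inj₂ y ∷ q′) ++ []              ≡⟨ cong (_++ []) (reverse-++ q (inj₂ y ∷ q′)) ⟩
      (reverse (inj₂ y ∷ q′) ++ reverse q) ++ []    ≡⟨ cong (λ t → (t ++ reverse q) ++ []) (unfold-reverse (inj₂ y) q′) ⟩
      ((reverse q′ ++ inj₂ y ∷ []) ++ reverse q) ++ [] ≡⟨ cong (_++ []) (++-assoc (reverse q′) _ _) ⟩
      (reverse q′ ++ inj₂ y ∷ reverse q) ++ []      ≡⟨ ++-assoc (reverse q′) _ _ ⟩
      reverse q′ ++ inj₂ y ∷ (reverse q ++ [])      ∎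
      where open ≡-Reasoning
    back-reference-≤ : suc k′ ≤ suc (length (reverse q′))
    back-reference-≤ = dist-≤-occurrence y (reverse q′) (reverse q ++ []) (trans (cong (dist y) (sym reversed)) d₂)
    q′<q′ : suc (length q′) < suc (length q′)
    q′<q′ = begin-strict
      suc (length q′)              <⟨ m<n+m (suc (length q′)) {suc k} (s≤s z≤n) ⟩
      suc k + suc (length q′)      ≡⟨ cong (_+ suc (length q′)) (sym length-q) ⟩
      length q + suc (length q′)   ≡⟨ sym (length-++ q) ⟩
      length (q ++ inj₂ y ∷ q′)    ≡⟨ cong length (sym split) ⟩
      length prefix                ≡⟨ length-prefix ⟩
      suc k′                       ≤⟨ back-reference-≤ ⟩
      suc (length (reverse q′))    ≡⟨ cong suc (length-reverse q′) ⟩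
      suc (length q′)              ∎
      where open ≤-Reasoning

module _ {σ : ℕ} where

  angleSym : ℕ → PVSym σ → PVSym σ
  angleSym i (inj₁ a) = inj₁ a
  angleSym i (inj₂ n) = inj₂ (if i <ᵇ n + 1 then 0 else n)

  angleGo-++ : (k i : ℕ) (x y : PVStr σ) → angleGo k i (x ++ y) ≡ angleGo k i x ++ angleGo k (i + length x) y
  angleGo-++ k i [] y = cong (λ t → angleGo k t y) (sym (+-identityʳ i))
  angleGo-++ k i (inj₁ a ∷ x) y =
    cong (inj₁ a ∷_) (trans (angleGo-++ k (suc i) x y) (cong (λ t → angleGo k (suc i) x ++ angleGo k t y) (sym (+-suc i (length x)))))
  angleGo-++ k i (inj₂ a ∷ x) y =
    cong (_ ∷_) (trans (angleGo-++ k (suc i) x y) (cong (λ t → angleGo k (suc i) x ++ angleGo k t y) (sym (+-suc i (length x)))))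

  take-angleGo : (m k i : ℕ) (x : PVStr σ) → take m (angleGo k i x) ≡ angleGo k i (take m x)
  take-angleGo zero k i x = refl
  take-angleGo (suc m) k i [] = refl
  take-angleGo (suc m) k i (inj₁ a ∷ x) = cong (_ ∷_) (take-angleGo m k (suc i) x)
  take-angleGo (suc m) k i (inj₂ a ∷ x) = cong (_ ∷_) (take-angleGo m k (suc i) x)

  length-angleGo : (k i : ℕ) (x : PVStr σ) → length (angleGo k i x) ≡ length x
  length-angleGo k i [] = refl
  length-angleGo k i (inj₁ a ∷ x) = cong suc (length-angleGo k (suc i) x)
  length-angleGo k i (inj₂ a ∷ x) = cong suc (length-angleGo k (suc i) x)

  at-angleGo : (j i : ℕ) (x : PVStr σ) → at (suc j) (angleGo 1 i x) ≡ Maybe.map (angleSym (i + j)) (at (suc j) x)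
  at-angleGo j i [] = refl
  at-angleGo zero i (inj₁ a ∷ x) = refl
  at-angleGo zero i (inj₂ n ∷ x) = cong (λ t → just (inj₂ (if t <ᵇ n + 1 then 0 else n))) (sym (+-identityʳ i))
  at-angleGo (suc j) i (inj₁ a ∷ x) =
    trans (at-angleGo j (suc i) x) (cong (λ t → Maybe.map (angleSym t) (at (suc j) x)) (sym (+-suc i j)))
  at-angleGo (suc j) i (inj₂ a ∷ x) =
    trans (at-angleGo j (suc i) x) (cong (λ t → Maybe.map (angleSym t) (at (suc j) x)) (sym (+-suc i j)))

  sl-++ : (u x : PVStr σ) → u ≢ [] → sl (u ++ x) ≡ sl u ++ angleGo 1 (length u) x
  sl-++ [] x nz = ⊥-elim (nz refl)
  sl-++ (c ∷ u) x nz = angleGo-++ 1 1 u x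

  angleSym-unchanged : (i : ℕ) (s : PVSym σ) → (∀ n → s ≡ inj₂ n → n ≤ i) → (∀ n → s ≡ inj₂ n → n ≢ i) →
    angleSym i s ≡ s
  angleSym-unchanged i (inj₁ a) bounded distinct = refl
  angleSym-unchanged i (inj₂ n) bounded distinct with i <ᵇ n + 1 in eq
  ... | false = refl
  ... | true = ⊥-elim (distinct n refl (≤-antisym (bounded n refl) i≤n))
    where
    i≤n : i ≤ n
    i≤n = ≤-pred (subst (suc i ≤_) (+-comm n 1) (<ᵇ⇒< i (n + 1) (true⇒T eq)))

  angleSym-self : (i : ℕ) → angleSym i (inj₂ {A = Fin σ} i) ≡ inj₂ 0
  angleSym-self i with i <ᵇ i + 1 in eq
  ... | true = refl
  ... | false = ⊥-elim (false⇒¬T eq (<⇒<ᵇ (subst (i <_) (+-comm 1 i) ≤-refl)))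

-- How Re(v) is read off the edge label α = str(u, v) with b = |u|: a value b + t at position t + 1
-- refers back to u[1]; j₀ counts the symbols reGo has already skipped.
data ReView {σ : ℕ} (b j₀ : ℕ) (α : PVStr σ) : ℕ → Set where
  none  : (∀ t → at (suc t) α ≢ just (inj₂ (b + t))) → ReView b j₀ α 0
  found : ∀ t → at (suc t) α ≡ just (inj₂ (b + t)) → ReView b j₀ α (suc (j₀ + t))

ReView-∷ : ∀ {σ j₀ b R} {x : PVSym σ} {α : PVStr σ} →
  x ≢ inj₂ (j₀ + b) → ReView (suc j₀ + b) (suc j₀) α R → ReView (j₀ + b) j₀ (x ∷ α) R
ReView-∷ {j₀ = j₀} {b} {x = x} {α} x≢ (none f) = none not-here
  where
  not-here : ∀ t → at (suc t) (x ∷ α) ≢ just (inj₂ (j₀ + b + t))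
  not-here zero h = x≢ (trans (just-injective h) (cong inj₂ (+-identityʳ (j₀ + b))))
  not-here (suc t) h = f t (trans h (cong (λ z → just (inj₂ z)) (+-suc (j₀ + b) t)))
ReView-∷ {j₀ = j₀} {b} x≢ (found t h) =
  subst (ReView _ _ _) (cong suc (+-suc j₀ t))
    (found (suc t) (trans h (cong (λ z → just (inj₂ z)) (sym (+-suc (j₀ + b) t)))))

+-suc-∸1 : ∀ b j → b + suc j ∸ 1 ≡ j + b
+-suc-∸1 b j = trans (cong (_∸ 1) (+-suc b j)) (+-comm b j)

module _ {σ π : ℕ} (T : List (Sym σ π)) where
  open PLST T using (reGo; Re)

  reGo-view : (b j₀ : ℕ) (α : PVStr σ) → ReView (j₀ + b) j₀ α (reGo b (suc j₀) α)
  reGo-view b j₀ [] = none (λ t ())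
  reGo-view b j₀ (inj₁ a ∷ α) = ReView-∷ (λ ()) (reGo-view b (suc j₀) α)
  reGo-view b j₀ (inj₂ n ∷ α) with n ≡ᵇ (b + suc j₀ ∸ 1) in eq
  ... | true = subst (ReView _ _ _) (cong suc (+-identityʳ j₀))
                 (found 0 (cong (λ z → just (inj₂ z)) (trans n≡ (sym (+-identityʳ (j₀ + b))))))
    where
    n≡ : n ≡ j₀ + b
    n≡ = trans (≡ᵇ⇒≡ n _ (true⇒T eq)) (+-suc-∸1 b j₀)
  ... | false = ReView-∷ (λ e → false⇒¬T eq (≡⇒≡ᵇ n _ (trans (inj₂-injective e) (sym (+-suc-∸1 b j₀)))))
                  (reGo-view b (suc j₀) α)

  Re-view : (u v : PVStr σ) → ReView (length u) 0 (str u v) (Re u v)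
  Re-view u v = reGo-view (length u) 0 (str u v)

-- Step (b) of P-Match: resetting the back-reference at position Re(v) turns comparison with the edge
-- label α into comparison with its image ⟨α⟩ below the suffix link.
module ReUpdate {σ : ℕ} (b : ℕ) (α : PVStr σ)
  (bounded : ∀ j n → at (suc j) α ≡ just (inj₂ n) → n ≤ b + j)
  (unique : ∀ j j′ → at (suc j) α ≡ just (inj₂ (b + j)) → at (suc j′) α ≡ just (inj₂ (b + j′)) → j ≡ j′)
  (P : PVStr σ) where

  α′ : PVStr σ
  α′ = angleGo 1 b α

  update : ℕ → PVStr σ
  update R = if (1 ≤ᵇ R) ∧ (R ≤ᵇ length P) then setAt R (inj₂ 0) P else P

  CheckOK : ℕ → Set
  CheckOK R = 1 ≤ R → R ≤ length P → at R P ≡ just (inj₂ (b + R ∸ 1))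

  length-update : ∀ R → length (update R) ≡ length P
  length-update R with (1 ≤ᵇ R) ∧ (R ≤ᵇ length P)
  ... | true = length-setAt R (inj₂ 0) P
  ... | false = refl

  at-α′-unchanged : ∀ j → at (suc j) α ≢ just (inj₂ (b + j)) → at (suc j) α′ ≡ at (suc j) α
  at-α′-unchanged j ne rewrite at-angleGo j b α with at (suc j) α in eq
  ... | nothing = refl
  ... | just s = cong just (angleSym-unchanged (b + j) s (λ n e → bounded j n (trans eq (cong just e)))
                                                     (λ n e e′ → ne (trans (cong just e) (cong (λ z → just (inj₂ z)) e′))))

  at-α′-self : ∀ t → at (suc t) α ≡ just (inj₂ (b + t)) → at (suc t) α′ ≡ just (inj₂ 0)
  at-α′-self t e rewrite at-angleGo t b α | e = cong just (angleSym-self (b + t))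

  not-self : ∀ t j → at (suc t) α ≡ just (inj₂ (b + t)) → j ≢ t → at (suc j) α ≢ just (inj₂ (b + j))
  not-self t j h ne h′ = ne (unique j t h′ h)

  module _ (l : ℕ) (l≤P : l ≤ length P) (l≤α : l ≤ length α) where

    angle-match⇒at-match : (R : ℕ) → ReView b 0 α R → take l (update R) ≡ take l α′ → CheckOK R →
      ∀ j → j < l → at (suc j) P ≡ at (suc j) α
    angle-match⇒at-match .0 (none f) H ok j lt = trans (take-≡⇒at-≡ l P α′ H j lt) (at-α′-unchanged j (f j))
    angle-match⇒at-match .(suc t) (found t h) H ok j lt with suc t ≤ᵇ length P in t<P
    ... | false = trans (take-≡⇒at-≡ l P α′ H j lt) (at-α′-unchanged j (not-self t j h j≢t))
      where
      j≢t : j ≢ t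
      j≢t refl = false⇒¬T t<P (≤⇒≤ᵇ (≤-trans lt l≤P))
    ... | true with j ≟ t
    ... | yes refl = trans (ok (s≤s z≤n) (≤ᵇ⇒≤ (suc t) (length P) (true⇒T t<P)))
                           (trans (cong (λ z → just (inj₂ z)) (cong (_∸ 1) (+-suc b t))) (sym h))
    ... | no j≢t = trans (sym (at-setAt-≢ j t (inj₂ 0) P j≢t))
                         (trans (take-≡⇒at-≡ l _ α′ H j lt) (at-α′-unchanged j (not-self t j h j≢t)))

    angle-match⇒match : (R : ℕ) → ReView b 0 α R → take l (update R) ≡ take l α′ → CheckOK R →
      take l P ≡ take l α
    angle-match⇒match R view H ok = take-≡-pointwise l P α l≤P l≤α (angle-match⇒at-match R view H ok)

    match⇒at-angle-match : (R : ℕ) → ReView b 0 α R → take l P ≡ take l α →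
      ∀ j → j < l → at (suc j) (update R) ≡ at (suc j) α′
    match⇒at-angle-match .0 (none f) H j lt = trans (take-≡⇒at-≡ l P α H j lt) (sym (at-α′-unchanged j (f j)))
    match⇒at-angle-match .(suc t) (found t h) H j lt with suc t ≤ᵇ length P in t<P
    ... | false = trans (take-≡⇒at-≡ l P α H j lt) (sym (at-α′-unchanged j (not-self t j h j≢t)))
      where
      j≢t : j ≢ t
      j≢t refl = false⇒¬T t<P (≤⇒≤ᵇ (≤-trans lt l≤P))
    ... | true with j ≟ t
    ... | yes refl = trans (at-setAt-≡ t (inj₂ 0) P (≤ᵇ⇒≤ (suc t) (length P) (true⇒T t<P))) (sym (at-α′-self t h))
    ... | no j≢t = trans (at-setAt-≢ j t (inj₂ 0) P j≢t)
                         (trans (take-≡⇒at-≡ l P α H j lt) (sym (at-α′-unchanged j (not-self t j h j≢t))))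

    match⇒angle-match : (R : ℕ) → ReView b 0 α R → take l P ≡ take l α → take l (update R) ≡ take l α′
    match⇒angle-match R view H =
      take-≡-pointwise l (update R) α′ (subst (l ≤_) (sym (length-update R)) l≤P)
        (subst (l ≤_) (sym (length-angleGo 1 b α)) l≤α) (match⇒at-angle-match R view H)

  module _ (l : ℕ) (l≡ : l ≡ length P ⊓ length α) where

    <-min : ∀ t → t < length P → t < length α → t < l
    <-min t h₁ h₂ = subst (t <_) (sym l≡) (⊓-glb h₁ h₂)

    match⇒CheckOK : (R : ℕ) → ReView b 0 α R → take l P ≡ take l α → CheckOK R
    match⇒CheckOK .0 (none f) H ()
    match⇒CheckOK .(suc t) (found t h) H _ t<P =
      trans (take-≡⇒at-≡ l P α H t (<-min t t<P (at⇒< t α h)))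
            (trans h (cong (λ z → just (inj₂ z)) (sym (cong (_∸ 1) (+-suc b t)))))

    drop-update : (R : ℕ) → ReView b 0 α R → drop l (update R) ≡ drop l P
    drop-update .0 (none f) = refl
    drop-update .(suc t) (found t h) with suc t ≤ᵇ length P in t<P
    ... | false = refl
    ... | true = drop-setAt l t (inj₂ 0) P (<-min t (≤ᵇ⇒≤ (suc t) (length P) (true⇒T t<P)) (at⇒< t α h))

module _ {σ π : ℕ} where

  module _ (g : Sym σ π → Sym σ π) (g-injective : ∀ {x y} → g x ≡ g y → x ≡ y)
           (g-fixes : ∀ a → g (inj₁ a) ≡ inj₁ a) where

    g-param : ∀ y → Σ (Fin π) λ y′ → g (inj₂ y) ≡ inj₂ y′
    g-param y with g (inj₂ y) in eq
    ... | inj₂ y′ = y′ , refl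
    ... | inj₁ a with g-injective {inj₂ y} {inj₁ a} (trans eq (sym (g-fixes a)))
    ... | ()

    dist-map : ∀ y y′ r → g (inj₂ y) ≡ inj₂ y′ → dist y′ (map g r) ≡ dist y r
    dist-map y y′ [] e = refl
    dist-map y y′ (inj₁ a ∷ r) e rewrite g-fixes a = cong (Maybe.map suc) (dist-map y y′ r e)
    dist-map y y′ (inj₂ z ∷ r) e with g-param z
    ... | z′ , ez rewrite ez with y′ ≟F z′ | y ≟F z
    ... | yes _ | yes _ = refl
    ... | no _ | no _ = cong (Maybe.map suc) (dist-map y y′ r e)
    ... | yes refl | no y≢z = ⊥-elim (y≢z (inj₂-injective (g-injective (trans e (sym ez)))))
    ... | no y′≢z′ | yes refl = ⊥-elim (y′≢z′ (inj₂-injective (trans (sym e) ez)))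

    preGo-map : ∀ r w → preGo (map g r) (map g w) ≡ preGo r w
    preGo-map r [] = refl
    preGo-map r (inj₁ a ∷ w) rewrite g-fixes a =
      cong (inj₁ a ∷_) (subst (λ z → preGo (z ∷ map g r) (map g w) ≡ _) (g-fixes a) (preGo-map (inj₁ a ∷ r) w))
    preGo-map r (inj₂ y ∷ w) with g-param y
    ... | y′ , ey rewrite ey =
      cong₂ _∷_ (cong (λ z → inj₂ (maybe (λ n → n) 0 z)) (dist-map y y′ r ey))
                (subst (λ z → preGo (z ∷ map g r) (map g w) ≡ _) ey (preGo-map (inj₂ y ∷ r) w))

  PMatches⇒pre≡ : (w P : List (Sym σ π)) → PMatches w P → pre w ≡ pre P
  PMatches⇒pre≡ w P (_ , f , fixes , e) =
    trans (sym (preGo-map (Bijection.to f) (Bijection.injective f) fixes [] w)) (cong pre e)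

  liftPerm : Permutation′ π → Sym σ π → Sym σ π
  liftPerm ρ (inj₁ a) = inj₁ a
  liftPerm ρ (inj₂ y) = inj₂ (ρ ⟨$⟩ʳ y)

  liftPerm-bijection : Permutation′ π → Sym σ π ⤖ Sym σ π
  liftPerm-bijection ρ = mk⤖ {to = liftPerm ρ} (injective , surjective)
    where
    injective : ∀ {x y} → liftPerm ρ x ≡ liftPerm ρ y → x ≡ y
    injective {inj₁ a} {inj₁ b} refl = refl
    injective {inj₂ a} {inj₂ b} e =
      cong inj₂ (trans (sym (inverseˡ ρ)) (trans (cong (ρ ⟨$⟩ˡ_) (inj₂-injective e)) (inverseˡ ρ)))
    surjective : ∀ y → ∃ λ x → ∀ {z} → z ≡ x → liftPerm ρ z ≡ y
    surjective (inj₁ a) = inj₁ a , λ { refl → refl }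
    surjective (inj₂ b) = inj₂ (ρ ⟨$⟩ˡ b) , λ { refl → cong inj₂ (inverseʳ ρ) }

  transpose-applyˡ : (i j : Fin π) → transpose i j ⟨$⟩ʳ i ≡ j
  transpose-applyˡ i j rewrite dec-true (i ≟F i) refl = refl

  transpose-apply-other : (i j k : Fin π) → k ≢ i → k ≢ j → transpose i j ⟨$⟩ʳ k ≡ k
  transpose-apply-other i j k k≢i k≢j rewrite dec-false (k ≟F i) k≢i | dec-false (k ≟F j) k≢j = refl

  dist-at : ∀ y (r : List (Sym σ π)) {k} → dist y r ≡ just k → at k r ≡ just (inj₂ y)
  dist-at y [] ()
  dist-at y (inj₁ a ∷ r) e with dist y r in eq
  dist-at y (inj₁ a ∷ r) refl | just (suc k) = dist-at y r eq
  dist-at y (inj₁ a ∷ r) refl | just zero with dist-bounds y r eq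
  ... | () , _
  dist-at y (inj₂ z ∷ r) e with y ≟F z
  dist-at y (inj₂ z ∷ r) refl | yes refl = refl
  ... | no _ with dist y r in eq
  dist-at y (inj₂ z ∷ r) refl | no _ | just (suc k) = dist-at y r eq
  dist-at y (inj₂ z ∷ r) refl | no _ | just zero with dist-bounds y r eq
  ... | () , _

  map-liftPerm-transpose : ∀ (ρ : Permutation′ π) y y′ (r : List (Sym σ π)) →
    dist y r ≡ nothing → dist y′ (map (liftPerm ρ) r) ≡ nothing →
    map (liftPerm (ρ ∘ₚ transpose (ρ ⟨$⟩ʳ y) y′)) r ≡ map (liftPerm ρ) r
  map-liftPerm-transpose ρ y y′ [] _ _ = refl
  map-liftPerm-transpose ρ y y′ (inj₁ a ∷ r) e₁ e₂ with dist y r in q₁ | dist y′ (map (liftPerm ρ) r) in q₂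
  ... | nothing | nothing = cong (inj₁ a ∷_) (map-liftPerm-transpose ρ y y′ r q₁ q₂)
  map-liftPerm-transpose ρ y y′ (inj₂ z ∷ r) e₁ e₂ with y ≟F z | y′ ≟F ρ ⟨$⟩ʳ z
  map-liftPerm-transpose ρ y y′ (inj₂ z ∷ r) () e₂ | yes _ | _
  map-liftPerm-transpose ρ y y′ (inj₂ z ∷ r) e₁ () | no _ | yes _
  ... | no y≢z | no y′≢ρz with dist y r in q₁ | dist y′ (map (liftPerm ρ) r) in q₂
  ... | nothing | nothing =
    cong₂ _∷_ (cong inj₂ (transpose-apply-other _ _ _ ρz≢ρy (λ e → y′≢ρz (sym e))))
              (map-liftPerm-transpose ρ y y′ r q₁ q₂)
    where
    ρz≢ρy : ρ ⟨$⟩ʳ z ≢ ρ ⟨$⟩ʳ y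
    ρz≢ρy e = y≢z (trans (sym (inverseˡ ρ)) (trans (cong (ρ ⟨$⟩ˡ_) (sym e)) (inverseˡ ρ)))

  extend-renaming : ∀ (ρ : Permutation′ π) (r r′ w w′ : List (Sym σ π)) →
    map (liftPerm ρ) r ≡ r′ → preGo r w ≡ preGo r′ w′ →
    Σ (Permutation′ π) λ ρ′ → map (liftPerm ρ′) r ≡ r′ × map (liftPerm ρ′) w ≡ w′
  extend-renaming ρ r r′ [] [] er e = ρ , er , refl
  extend-renaming ρ r r′ [] (inj₁ b ∷ w′) er ()
  extend-renaming ρ r r′ [] (inj₂ b ∷ w′) er ()
  extend-renaming ρ r r′ (inj₁ a ∷ w) (inj₁ b ∷ w′) er e with ∷-injectiveˡ e
  ... | refl with extend-renaming ρ (inj₁ a ∷ r) (inj₁ a ∷ r′) w w′ (cong (inj₁ a ∷_) er) (∷-injectiveʳ e)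
  ... | ρ′ , er′ , ew = ρ′ , ∷-injectiveʳ er′ , cong (inj₁ a ∷_) ew
  extend-renaming ρ r r′ (inj₂ y ∷ w) (inj₂ y′ ∷ w′) er e =
    continue (rename-head (dist y r) (dist y′ r′) refl refl (inj₂-injective (∷-injectiveˡ e)))
    where
    rename-head : (m₁ m₂ : Maybe ℕ) → dist y r ≡ m₁ → dist y′ r′ ≡ m₂ →
      maybe (λ n → n) 0 m₁ ≡ maybe (λ n → n) 0 m₂ →
      Σ (Permutation′ π) λ ρ′ → map (liftPerm ρ′) r ≡ r′ × ρ′ ⟨$⟩ʳ y ≡ y′
    rename-head (just k) (just .k) q₁ q₂ refl = ρ , er , inj₂-injective (just-injective (begin
      just (liftPerm ρ (inj₂ y))           ≡⟨ cong (Maybe.map (liftPerm ρ)) (sym (dist-at y r q₁)) ⟩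
      Maybe.map (liftPerm ρ) (at k r)      ≡⟨ sym (at-map (liftPerm ρ) k r) ⟩
      at k (map (liftPerm ρ) r)            ≡⟨ cong (at k) er ⟩
      at k r′                              ≡⟨ dist-at y′ r′ q₂ ⟩
      just (inj₂ y′)                       ∎))
      where open ≡-Reasoning
    rename-head (just zero) nothing q₁ q₂ refl with dist-bounds y r q₁
    ... | () , _
    rename-head nothing (just zero) q₁ q₂ refl with dist-bounds y′ r′ q₂
    ... | () , _
    rename-head nothing nothing q₁ q₂ _ =
      ρ ∘ₚ transpose (ρ ⟨$⟩ʳ y) y′ ,
      trans (map-liftPerm-transpose ρ y y′ r q₁ (trans (cong (dist y′) er) q₂)) er ,
      transpose-applyˡ (ρ ⟨$⟩ʳ y) y′
    continue : (Σ (Permutation′ π) λ ρ′ → map (liftPerm ρ′) r ≡ r′ × ρ′ ⟨$⟩ʳ y ≡ y′) →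
      Σ (Permutation′ π) λ ρ′ → map (liftPerm ρ′) r ≡ r′ × map (liftPerm ρ′) (inj₂ y ∷ w) ≡ inj₂ y′ ∷ w′
    continue (ρ₁ , er₁ , ey) with extend-renaming ρ₁ (inj₂ y ∷ r) (inj₂ y′ ∷ r′) w w′ (cong₂ _∷_ (cong inj₂ ey) er₁) (∷-injectiveʳ e)
    ... | ρ′ , er′ , ew = ρ′ , ∷-injectiveʳ er′ , cong₂ _∷_ (∷-injectiveˡ er′) ew

  pre≡⇒PMatches : (w P : List (Sym σ π)) → pre w ≡ pre P → PMatches w P
  pre≡⇒PMatches w P e with extend-renaming Permutation.id [] [] w P refl e
  ... | ρ , _ , ew = trans (sym (length-preGo [] w)) (trans (cong length e) (length-preGo [] P)) ,
                     liftPerm-bijection ρ , (λ a → refl) , ew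

earlier-occurrence : {A : Set} (X Y y : List A) (z : A) → X ++ z ∷ y ≡ Y ++ z ∷ [] → y ≢ [] → z ∈ Y
earlier-occurrence [] [] y z e y≢[] = ⊥-elim (y≢[] (∷-injectiveʳ e))
earlier-occurrence [] (t ∷ Y) y z e y≢[] = here (∷-injectiveˡ e)
earlier-occurrence (x ∷ []) [] y z () y≢[]
earlier-occurrence (x ∷ x′ ∷ X) [] y z () y≢[]
earlier-occurrence (x ∷ X) (t ∷ Y) y z e y≢[] = there (earlier-occurrence X Y y z (∷-injectiveʳ e) y≢[])

-- Every suffix of T₀ $ ends with the unique sentinel $, so no substring extends it.
sentinel-suffix-leaf : ∀ {σ π} (T₀ : List (Sym σ π)) (d : Fin σ) → inj₁ d ∉ T₀ →
  ∀ i → i < length (T₀ ++ inj₁ d ∷ []) → PLST.IsLeaf (T₀ ++ inj₁ d ∷ []) (pre (drop i (T₀ ++ inj₁ d ∷ [])))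
sentinel-suffix-leaf T₀ d d∉T₀ i i<T b (w , (A , B , eT) , ew) =
  d∉T₀ (earlier-occurrence (A ++ w₁) T₀ (w₂ ++ B) (inj₁ d) T≡ w₂++B≢[])
  where
  T = T₀ ++ inj₁ d ∷ []
  i≤T₀ : i ≤ length T₀
  i≤T₀ = ≤-pred (subst (i <_) (trans (length-++ T₀) (+-comm (length T₀) 1)) i<T)
  Z₀ = drop i T₀
  K₀ = length Z₀
  drop-i : drop i T ≡ Z₀ ++ inj₁ d ∷ []
  drop-i = drop-++-≤ i T₀ (inj₁ d ∷ []) i≤T₀
  length-suffix : length (pre (drop i T)) ≡ suc K₀
  length-suffix = trans (length-preGo [] (drop i T)) (trans (cong length drop-i) (trans (length-++ Z₀) (+-comm K₀ 1)))
  at-suffix : at (suc K₀) (pre (drop i T)) ≡ just (inj₁ d)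
  at-suffix = trans (at-preGo K₀ [] (drop i T))
    (cong (Maybe.map _) (trans (cong (at (suc K₀)) drop-i) (trans (cong (λ z → at z (Z₀ ++ inj₁ d ∷ [])) (+-comm 1 K₀)) (at-++ʳ Z₀ (inj₁ d ∷ []) 0))))
  at-w : at (suc K₀) w ≡ just (inj₁ d)
  at-w = pre-at-const K₀ w (trans (cong (at (suc K₀)) ew)
           (trans (at-++ˡ (suc K₀) (pre (drop i T)) (b ∷ []) (≤-reflexive (sym length-suffix))) at-suffix))
  split = at-split K₀ w at-w
  w₁ = proj₁ split
  w₂ = proj₁ (proj₂ split)
  w≡ : w ≡ w₁ ++ inj₁ d ∷ w₂
  w≡ = proj₁ (proj₂ (proj₂ split))
  length-w : K₀ + suc (length w₂) ≡ K₀ + 2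
  length-w = begin
    K₀ + suc (length w₂)              ≡⟨ cong (_+ suc (length w₂)) (sym (proj₂ (proj₂ (proj₂ split)))) ⟩
    length w₁ + suc (length w₂)       ≡⟨ sym (length-++ w₁) ⟩
    length (w₁ ++ inj₁ d ∷ w₂)        ≡⟨ cong length (sym w≡) ⟩
    length w                          ≡⟨ sym (length-preGo [] w) ⟩
    length (pre w)                    ≡⟨ cong length ew ⟩
    length (pre (drop i T) ++ b ∷ []) ≡⟨ length-++ (pre (drop i T)) ⟩
    length (pre (drop i T)) + 1       ≡⟨ cong (_+ 1) (trans length-suffix (+-comm 1 K₀)) ⟩
    K₀ + 1 + 1                        ≡⟨ +-assoc K₀ 1 1 ⟩
    K₀ + 2                            ∎
    where open ≡-Reasoning
  w₂++B≢[] : w₂ ++ B ≢ []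
  w₂++B≢[] with w₂ | suc-injective (+-cancelˡ-≡ K₀ _ _ length-w)
  ... | _ ∷ _ | _ = λ ()
  T≡ : (A ++ w₁) ++ inj₁ d ∷ (w₂ ++ B) ≡ T₀ ++ inj₁ d ∷ []
  T≡ = sym (trans eT (trans (cong (λ z → A ++ (z ++ B)) w≡)
                       (trans (cong (A ++_) (++-assoc w₁ _ B)) (sym (++-assoc A w₁ _)))))

least-in-range : {Q : ℕ → Set} → (∀ k → Dec (Q k)) → (s K : ℕ) → s ≤ K → Q K →
  Σ ℕ λ m → s ≤ m × m ≤ K × Q m × (∀ j → s ≤ j → j < m → ¬ Q j)
least-in-range {Q} Q? s K s≤K qK = search (K ∸ s) s (m∸n+n≡m s≤K)
  where
  search : (f s : ℕ) → f + s ≡ K → Σ ℕ λ m → s ≤ m × m ≤ K × Q m × (∀ j → s ≤ j → j < m → ¬ Q j)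
  search f s e with Q? s
  ... | yes qs = s , ≤-refl , subst (s ≤_) e (m≤n+m s f) , qs , λ j s≤j j<s → ⊥-elim (<-irrefl refl (≤-trans j<s s≤j))
  search zero s e | no ¬qs = ⊥-elim (¬qs (subst Q (sym e) qK))
  search (suc f) s e | no ¬qs with search f (suc s) (trans (+-suc f s) e)
  ... | m , s<m , m≤K , qm , below = m , ≤-trans (n≤1+n s) s<m , m≤K , qm , below′
    where
    below′ : ∀ j → s ≤ j → j < m → ¬ Q j
    below′ j s≤j j<m with m≤n⇒m<n∨m≡n s≤j
    ... | inj₁ s<j = below j s<j j<m
    ... | inj₂ refl = ¬qs

module _ {σ π : ℕ} (T : List (Sym σ π)) where
  open PLST T

  _≟V_ : (x y : PVSym σ) → Dec (x ≡ y)
  _≟V_ = Sum.≡-dec _≟F_ _≟_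

  _≟L_ : (x y : PVStr σ) → Dec (x ≡ y)
  _≟L_ = List.≡-dec _≟V_

  PrevSub-prefix : (x y : PVStr σ) → PrevSub (x ++ y) → PrevSub x
  PrevSub-prefix x y (w , (a , b , eT) , ep) =
    take (length x) w ,
    (a , drop (length x) w ++ b ,
      trans eT (cong (a ++_) (trans (cong (_++ b) (sym (take++drop≡id (length x) w))) (++-assoc (take (length x) w) _ b)))) ,
    trans (sym (take-preGo (length x) [] w)) (trans (cong (take (length x)) ep) (take-length-++ x y))

  PrevSub-++-take : (u x : PVStr σ) (k : ℕ) → PrevSub (u ++ x) → PrevSub (u ++ take k x)
  PrevSub-++-take u x k ps = PrevSub-prefix (u ++ take k x) (drop k x)
    (subst PrevSub (trans (cong (u ++_) (sym (take++drop≡id k x))) (sym (++-assoc u _ _))) ps)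

  PrevSub-sl : (x : PVStr σ) → PrevSub x → PrevSub (sl x)
  PrevSub-sl x ([] , s , refl) = [] , ([] , T , refl) , refl
  PrevSub-sl x (c ∷ w , (a , b , eT) , refl) =
    w , (a ++ (c ∷ []) , b , trans eT (sym (++-assoc a (c ∷ []) (w ++ b)))) , sym (sl-pre c w)

  V-[] : V []
  V-[] = inj₁ (([] , ([] , T , refl) , refl) , inj₁ refl)

  V⇒PrevSub : ∀ {x} → V x → PrevSub x
  V⇒PrevSub (inj₁ (p , _)) = p
  V⇒PrevSub (inj₂ (p , _)) = p

  ¬Type1⇒¬Branching : ∀ {x} → PrevSub x → ¬ Type1 x → ¬ IsBranching x
  ¬Type1⇒¬Branching ps ¬t br = ¬t (ps , inj₂ (inj₂ br))

  unary-path-determined : (l : ℕ) (s x y : PVStr σ) → l ≤ length x → l ≤ length y →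
    (∀ k → 1 ≤ k → k < l → ¬ IsBranching (s ++ take k y)) →
    PrevSub (s ++ take l x) → PrevSub (s ++ take l y) → take 1 x ≡ take 1 y → take l x ≡ take l y
  unary-path-determined zero s x y _ _ _ _ _ _ = refl
  unary-path-determined (suc zero) s x y _ _ _ _ _ e = e
  unary-path-determined (suc (suc l)) s (a ∷ c ∷ x) (.a ∷ d ∷ y) (s≤s (s≤s hx)) (s≤s (s≤s hy)) unary px py refl =
    cong (a ∷_) (unary-path-determined (suc l) s′ (c ∷ x) (d ∷ y) (s≤s hx) (s≤s hy) unary′
                   (subst PrevSub (sym (++-assoc s (a ∷ []) _)) px) (subst PrevSub (sym (++-assoc s (a ∷ []) _)) py) c≡d)
    where
    s′ = s ++ a ∷ []
    unary′ : ∀ k → 1 ≤ k → k < suc l → ¬ IsBranching (s′ ++ take k (d ∷ y))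
    unary′ k h₁ h₂ br = unary (suc k) (s≤s z≤n) (s≤s h₂) (subst IsBranching (++-assoc s (a ∷ []) _) br)
    one-step : ∀ e z → PrevSub (s ++ a ∷ e ∷ z) → PrevSub (s′ ++ e ∷ [])
    one-step e z ps = subst PrevSub (sym (++-assoc s (a ∷ []) _)) (PrevSub-++-take s (a ∷ e ∷ z) 2 ps)
    c≡d : c ∷ [] ≡ d ∷ []
    c≡d with c ≟V d
    ... | yes e = cong (_∷ []) e
    ... | no ne = ⊥-elim (unary 1 (s≤s z≤n) (s≤s (s≤s z≤n)) (c , d , ne , one-step c _ px , one-step d _ py))

  at-pre-label : (u α : PVStr σ) (ps : PrevSub (u ++ α)) →
    ∀ j → at (suc (length u + j)) (pre (proj₁ ps)) ≡ at (suc j) α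
  at-pre-label u α (w , _ , ew) j =
    trans (cong (λ z → at z (pre w)) (sym (+-suc (length u) j))) (trans (cong (at (length u + suc j)) ew) (at-++ʳ u α j))

  label-bounded : (u α : PVStr σ) → PrevSub (u ++ α) →
    ∀ j n → at (suc j) α ≡ just (inj₂ n) → n ≤ length u + j
  label-bounded u α ps j n e = pre-at-≤ (length u + j) (proj₁ ps) (trans (at-pre-label u α ps j) e)

  label-self-reference-unique : (u α : PVStr σ) → PrevSub (u ++ α) → u ≢ [] → ∀ j j′ →
    at (suc j) α ≡ just (inj₂ (length u + j)) → at (suc j′) α ≡ just (inj₂ (length u + j′)) → j ≡ j′
  label-self-reference-unique [] α ps nz j j′ e e′ = ⊥-elim (nz refl)
  label-self-reference-unique u@(_ ∷ u₀) α ps nz j j′ e e′ with <-cmp j j′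
  ... | tri≈ _ j≡j′ _ = j≡j′
  ... | tri< j<j′ _ _ = ⊥-elim (pre-head-referenced-once (length u₀ + j) (length u + j′) (proj₁ ps)
                                  (+-monoʳ-< (length u) j<j′) (trans (at-pre-label u α ps j) e) (trans (at-pre-label u α ps j′) e′))
  ... | tri> _ _ j>j′ = ⊥-elim (pre-head-referenced-once (length u₀ + j′) (length u + j) (proj₁ ps)
                                  (+-monoʳ-< (length u) j>j′) (trans (at-pre-label u α ps j′) e′) (trans (at-pre-label u α ps j) e))

  module EdgeFacts {u v : PVStr σ} (E : Edge u v) where
    private
      β = proj₁ (proj₂ (proj₂ E))
      v≡u++β = proj₁ (proj₂ (proj₂ (proj₂ E)))
      β≢[] = proj₁ (proj₂ (proj₂ (proj₂ (proj₂ E))))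
      minimal = proj₂ (proj₂ (proj₂ (proj₂ (proj₂ E))))
      α≡β : str u v ≡ β
      α≡β = trans (cong (drop (length u)) v≡u++β) (drop-length-++ u β)

    α : PVStr σ
    α = str u v

    v≡u++α : v ≡ u ++ α
    v≡u++α = trans v≡u++β (cong (u ++_) (sym α≡β))

    V-v : V v
    V-v = proj₁ (proj₂ E)

    PrevSub-u++α : PrevSub (u ++ α)
    PrevSub-u++α = subst PrevSub v≡u++α (V⇒PrevSub V-v)

    interior-¬V : ∀ k → 1 ≤ k → k < length α → ¬ V (u ++ take k α)
    interior-¬V k h₁ h₂ = minimal (take k α) (drop k α) (trans (sym α≡β) (sym (take++drop≡id k α)))
      (take-nonempty k α h₁ (λ e → β≢[] (trans (sym α≡β) e))) (drop-nonempty k α h₂)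

    interior-unary : ∀ k → 1 ≤ k → k < length α → ¬ IsBranching (u ++ take k α)
    interior-unary k h₁ h₂ = ¬Type1⇒¬Branching (PrevSub-++-take u α k PrevSub-u++α) (λ t → interior-¬V k h₁ h₂ (inj₁ t))

    PrevSub-sl-u++α′ : u ≢ [] → PrevSub (sl u ++ angleGo 1 (length u) α)
    PrevSub-sl-u++α′ nz = subst PrevSub (sl-++ u α nz) (PrevSub-sl _ PrevSub-u++α)

    -- A Type 1 node on the path below sl u would make its preimage on the edge a Type 2 node.
    sl-interior-unary : u ≢ [] → ∀ k → 1 ≤ k → k < length α → ¬ IsBranching (sl u ++ take k (angleGo 1 (length u) α))
    sl-interior-unary nz k h₁ h₂ = ¬Type1⇒¬Branching (subst PrevSub sl-x (PrevSub-sl x ps)) ¬T1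
      where
      x = u ++ take k α
      ps = PrevSub-++-take u α k PrevSub-u++α
      sl-x : sl x ≡ sl u ++ take k (angleGo 1 (length u) α)
      sl-x = trans (sl-++ u (take k α) nz) (cong (sl u ++_) (sym (take-angleGo k 1 (length u) α)))
      ¬T1 : ¬ Type1 (sl u ++ take k (angleGo 1 (length u) α))
      ¬T1 t = interior-¬V k h₁ h₂ (inj₂ (ps , (λ t′ → interior-¬V k h₁ h₂ (inj₁ t′)) , subst Type1 (sym sl-x) t))

  module _ (u α P : PVStr σ) (l : ℕ) (l≡ : l ≡ length P ⊓ length α) (H : take l P ≡ take l α) where
    private
      P-exhausted-or-α-exhausted : drop l P ≡ [] ⊎ take l α ≡ α
      P-exhausted-or-α-exhausted with ⊓-sel (length P) (length α)
      ... | inj₁ e = inj₁ (drop-all l P (≤-reflexive (sym (trans l≡ e))))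
      ... | inj₂ e = inj₂ (take-all l α (≤-reflexive (sym (trans l≡ e))))

      u++P≡ : u ++ P ≡ (u ++ take l α) ++ drop l P
      u++P≡ = trans (cong (u ++_) (sym (take++drop≡id l P)))
                    (trans (cong (λ z → u ++ z ++ drop l P) H) (sym (++-assoc u _ _)))

    PrevSub-across-edge : PrevSub ((u ++ α) ++ drop l P) → PrevSub (u ++ P)
    PrevSub-across-edge ps with P-exhausted-or-α-exhausted
    ... | inj₁ P-done = subst PrevSub (sym (trans u++P≡ (trans (cong (_ ++_) P-done) (++-identityʳ _))))
                          (PrevSub-++-take u α l (subst PrevSub (trans (cong (_ ++_) P-done) (++-identityʳ _)) ps))
    ... | inj₂ α-done = subst PrevSub (sym (trans u++P≡ (cong (λ z → (u ++ z) ++ drop l P) α-done))) ps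

    PrevSub-beyond-edge : PrevSub (u ++ α) → PrevSub (u ++ P) → PrevSub ((u ++ α) ++ drop l P)
    PrevSub-beyond-edge psα psP with P-exhausted-or-α-exhausted
    ... | inj₁ P-done = subst PrevSub (sym (trans (cong (_ ++_) P-done) (++-identityʳ _))) psα
    ... | inj₂ α-done = subst PrevSub (trans u++P≡ (cong (λ z → (u ++ z) ++ drop l P) α-done)) psP

  PrevSub⇒occurrence : (x : PVStr σ) → PrevSub x →
    Σ ℕ λ i → i < suc (length T) × pre (take (length x) (drop i T)) ≡ x
  PrevSub⇒occurrence x (w , (a , b , eT) , ep) =
    length a , s≤s a≤T , trans (cong (λ z → pre (take (length x) z)) drop-a) (trans (cong pre take-x) ep)
    where
    a≤T : length a ≤ length T
    a≤T = subst (length a ≤_) (sym (trans (cong length eT) (length-++ a))) (m≤m+n _ _)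
    drop-a : drop (length a) T ≡ w ++ b
    drop-a = trans (cong (drop (length a)) eT) (drop-length-++ a (w ++ b))
    take-x : take (length x) (w ++ b) ≡ w
    take-x = trans (cong (λ z → take z (w ++ b)) (trans (cong length (sym ep)) (length-preGo [] w))) (take-length-++ w b)

  occurrence⇒PrevSub : (x : PVStr σ) (i : ℕ) → pre (take (length x) (drop i T)) ≡ x → PrevSub x
  occurrence⇒PrevSub x i e = take (length x) (drop i T) ,
    (take i T , drop (length x) (drop i T) ,
      trans (sym (take++drop≡id i T)) (cong (take i T ++_) (sym (take++drop≡id (length x) (drop i T))))) , e

  PrevSub? : (x : PVStr σ) → Dec (PrevSub x)
  PrevSub? x = map′ (λ (i , _ , e) → occurrence⇒PrevSub x i e) (PrevSub⇒occurrence x)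
                    (anyUpTo? (λ i → pre (take (length x) (drop i T)) ≟L x) (suc (length T)))

  private
    extension : PVStr σ → ℕ → PVStr σ
    extension x i = pre (take (length x + 1) (drop i T))

    Extends : PVStr σ → ℕ → Set
    Extends x i = length (extension x i) ≡ length x + 1 × take (length x) (extension x i) ≡ x

    Extends? : (x : PVStr σ) (i : ℕ) → Dec (Extends x i)
    Extends? x i = (length (extension x i) ≟ (length x + 1)) ×-dec (take (length x) (extension x i) ≟L x)

    PrevSub-∷ʳ⇒Extends : (x : PVStr σ) (a : PVSym σ) → PrevSub (x ++ a ∷ []) →
      Σ ℕ λ i → i < suc (length T) × Extends x i × drop (length x) (extension x i) ≡ a ∷ []
    PrevSub-∷ʳ⇒Extends x a ps with PrevSub⇒occurrence (x ++ a ∷ []) ps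
    ... | i , lt , e = i , lt , (trans (cong length ext≡) (length-++ x) , trans (cong (take (length x)) ext≡) (take-length-++ x _)) ,
                       trans (cong (drop (length x)) ext≡) (drop-length-++ x _)
      where
      ext≡ : extension x i ≡ x ++ a ∷ []
      ext≡ = trans (cong (λ z → pre (take z (drop i T))) (sym (length-++ x))) e

    length-new-symbol : (x : PVStr σ) (i : ℕ) → Extends x i → length (drop (length x) (extension x i)) ≡ 1
    length-new-symbol x i (length≡ , _) =
      trans (length-drop (length x) (extension x i)) (trans (cong (_∸ length x) length≡) (m+n∸m≡n (length x) 1))

    Extends⇒PrevSub-∷ʳ : (x : PVStr σ) (i : ℕ) → Extends x i →
      Σ (PVSym σ) λ a → drop (length x) (extension x i) ≡ a ∷ [] × PrevSub (x ++ a ∷ [])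
    Extends⇒PrevSub-∷ʳ x i ext with drop (length x) (extension x i) in d≡ | length-new-symbol x i ext
    ... | a ∷ [] | _ = a , refl , occurrence⇒PrevSub (x ++ a ∷ []) i (trans (cong (λ z → pre (take z (drop i T))) (length-++ x)) ext≡)
      where
      ext≡ : extension x i ≡ x ++ a ∷ []
      ext≡ = trans (sym (take++drop≡id (length x) (extension x i))) (cong₂ _++_ (proj₂ ext) d≡)

  IsLeaf? : (x : PVStr σ) → Dec (IsLeaf x)
  IsLeaf? x = map′ (λ ¬ext a ps → ¬ext (a , ps)) (λ leaf (a , ps) → leaf a ps) (¬? extensible?)
    where
    extensible? : Dec (Σ (PVSym σ) λ a → PrevSub (x ++ a ∷ []))
    extensible? = map′ (λ (i , _ , c) → let (a , _ , ps) = Extends⇒PrevSub-∷ʳ x i c in a , ps)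
                       (λ (a , ps) → let (i , lt , c , _) = PrevSub-∷ʳ⇒Extends x a ps in i , lt , c)
                       (anyUpTo? (Extends? x) (suc (length T)))

  IsBranching? : (x : PVStr σ) → Dec (IsBranching x)
  IsBranching? x = map′ to from (anyUpTo? (λ i → anyUpTo? (λ j → Distinct? i j) (suc (length T))) (suc (length T)))
    where
    Distinct : ℕ → ℕ → Set
    Distinct i j = Extends x i × Extends x j × drop (length x) (extension x i) ≢ drop (length x) (extension x j)
    Distinct? : ∀ i j → Dec (Distinct i j)
    Distinct? i j = Extends? x i ×-dec Extends? x j ×-dec ¬? (drop (length x) (extension x i) ≟L drop (length x) (extension x j))
    to : (Σ ℕ λ i → i < suc (length T) × Σ ℕ λ j → j < suc (length T) × Distinct i j) → IsBranching x
    to (i , _ , j , _ , ci , cj , ne) with Extends⇒PrevSub-∷ʳ x i ci | Extends⇒PrevSub-∷ʳ x j cj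
    ... | a , da , pa | b , db , pb = a , b , (λ a≡b → ne (trans da (trans (cong (_∷ []) a≡b) (sym db)))) , pa , pb
    from : IsBranching x → Σ ℕ λ i → i < suc (length T) × Σ ℕ λ j → j < suc (length T) × Distinct i j
    from (a , b , ne , pa , pb) with PrevSub-∷ʳ⇒Extends x a pa | PrevSub-∷ʳ⇒Extends x b pb
    ... | i , li , ci , da | j , lj , cj , db = i , li , j , lj , ci , cj , (λ e → ne (∷-injectiveˡ (trans (sym da) (trans e db))))

  Type1? : (x : PVStr σ) → Dec (Type1 x)
  Type1? x = PrevSub? x ×-dec ((x ≟L []) ⊎-dec IsLeaf? x ⊎-dec IsBranching? x)

  V? : (x : PVStr σ) → Dec (V x)
  V? x = Type1? x ⊎-dec (PrevSub? x ×-dec ¬? (Type1? x) ×-dec Type1? (sl x))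

  Good? : (x : PVStr σ) → Dec (Good x)
  Good? x = ¬? (x ≟L []) ×-dec V? (sl x)

  module _ (u y : PVStr σ) (m : ℕ) (u≼y : take (length u) y ≡ u) (u<m : length u < m) (m≤y : m ≤ length y) where
    private
      v = take m y
      β = drop (length u) v

      take-v : ∀ j → j ≤ m → take j v ≡ take j y
      take-v j j≤m = take-take-≤ j m y j≤m

      v≡u++β : v ≡ u ++ β
      v≡u++β = trans (sym (take++drop≡id (length u) v)) (cong (_++ β) (trans (take-v (length u) (<⇒≤ u<m)) u≼y))

      m≡ : m ≡ length u + length β
      m≡ = trans (sym (length-take-≤ m y m≤y)) (trans (cong length v≡u++β) (length-++ u))

    first-V-below⇒Edge : V u → V v → (∀ j → length u < j → j < m → ¬ V (take j y)) → Edge u v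
    first-V-below⇒Edge Vu Vv first = Vu , Vv , β , v≡u++β , β≢[] , minimal
      where
      β≢[] : β ≢ []
      β≢[] e = <-irrefl (sym (trans m≡ (trans (cong (λ z → length u + length z) e) (+-identityʳ (length u))))) u<m
      minimal : ∀ v′ v″ → β ≡ v′ ++ v″ → v′ ≢ [] → v″ ≢ [] → ¬ V (u ++ v′)
      minimal v′ v″ split nz′ nz″ V-uv′ = first j u<j j<m (subst V (sym take-j) V-uv′)
        where
        j = length u + length v′
        u<j : length u < j
        u<j = subst (_≤ j) (+-comm (length u) 1) (+-monoʳ-≤ (length u) (nonempty⇒1≤length v′ nz′))
        m≡j+ : m ≡ j + length v″
        m≡j+ = trans m≡ (trans (cong (λ z → length u + length z) split)
                          (trans (cong (length u +_) (length-++ v′)) (sym (+-assoc (length u) _ _))))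
        j<m : j < m
        j<m = subst (j <_) (sym m≡j+) (subst (_≤ j + length v″) (+-comm j 1) (+-monoʳ-≤ j (nonempty⇒1≤length v″ nz″)))
        take-j : take j y ≡ u ++ v′
        take-j = begin
          take j y               ≡⟨ sym (take-v j (subst (j ≤_) (sym m≡j+) (m≤m+n j _))) ⟩
          take j v               ≡⟨ cong (take j) (trans v≡u++β (cong (u ++_) split)) ⟩
          take j (u ++ v′ ++ v″) ≡⟨ take-length+-++ u _ (length v′) ⟩
          u ++ take (length v′) (v′ ++ v″) ≡⟨ cong (u ++_) (take-length-++ v′ v″) ⟩
          u ++ v′                ∎
          where open ≡-Reasoning

    str-first-V-below : (a : PVSym σ) → take (suc (length u)) y ≡ u ++ a ∷ [] → str u v ≡ a ∷ drop 1 β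
    str-first-V-below a head = head-of β take-1-β
      where
      take-1-β : take 1 β ≡ a ∷ []
      take-1-β = ++-cancelˡ u _ _ (begin
        u ++ take 1 β                ≡⟨ sym (take-length+-++ u β 1) ⟩
        take (length u + 1) (u ++ β) ≡⟨ cong (λ k → take k (u ++ β)) (+-comm (length u) 1) ⟩
        take (suc (length u)) (u ++ β) ≡⟨ cong (take (suc (length u))) (sym v≡u++β) ⟩
        take (suc (length u)) v      ≡⟨ take-v (suc (length u)) u<m ⟩
        take (suc (length u)) y      ≡⟨ head ⟩
        u ++ a ∷ []                  ∎)
        where open ≡-Reasoning
      head-of : (z : PVStr σ) → take 1 z ≡ a ∷ [] → z ≡ a ∷ drop 1 z
      head-of (_ ∷ _) refl = refl

  module _ (suffix-leaf : ∀ i → i < length T → IsLeaf (pre (drop i T))) where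

    child-exists : (u : PVStr σ) (a : PVSym σ) (q : PVStr σ) → V u → PrevSub (u ++ a ∷ q) →
      Σ (PVStr σ) λ v → IsChild u a v
    child-exists u a q Vu ps = let (i , _ , occ) = PrevSub⇒occurrence x ps in child-below i occ
      where
      x = u ++ a ∷ q
      n = length x
      u<n : length u < n
      u<n = subst (length u <_) (sym (length-++ u)) (m<m+n (length u) (s≤s z≤n))

      child-below : (i : ℕ) → pre (take n (drop i T)) ≡ x → Σ (PVStr σ) λ v → IsChild u a v
      child-below i occ = from-first (least-in-range (λ k → V? (take k y)) (suc (length u)) (length y) (≤-trans u<n n≤y) V-y)
        where
        y = pre (drop i T)
        take-n-y : take n y ≡ x
        take-n-y = trans (take-preGo n [] (drop i T)) occ
        n≤y : n ≤ length y
        n≤y = subst (_≤ length y) (trans (sym (length-take n y)) (cong length take-n-y)) (m⊓n≤n n (length y))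
        take-y : ∀ k → k ≤ n → take k y ≡ take k x
        take-y k k≤n = trans (sym (take-take-≤ k n y k≤n)) (cong (take k) take-n-y)
        u≼y : take (length u) y ≡ u
        u≼y = trans (take-y (length u) (<⇒≤ u<n)) (take-length-++ u (a ∷ q))
        head : take (suc (length u)) y ≡ u ++ a ∷ []
        head = trans (take-y (suc (length u)) u<n)
                     (trans (cong (λ k → take k x) (+-comm 1 (length u))) (take-length+-++ u (a ∷ q) 1))
        i<T : i < length T
        i<T = m∸n≢0⇒n<m λ T∸i≡0 → <-irrefl refl (≤-trans (≤-trans (s≤s z≤n) u<n)
                (subst (n ≤_) (trans (length-preGo [] (drop i T)) (trans (length-drop i T) T∸i≡0)) n≤y))
        V-y : V (take (length y) y)
        V-y = subst V (sym (take-length y))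
                (inj₁ ((drop i T , (take i T , [] , sym (trans (cong (take i T ++_) (++-identityʳ _)) (take++drop≡id i T))) , refl) ,
                       inj₂ (inj₁ (suffix-leaf i i<T))))
        from-first : (Σ ℕ λ m → suc (length u) ≤ m × m ≤ length y × V (take m y) ×
                       (∀ j → suc (length u) ≤ j → j < m → ¬ V (take j y))) → Σ (PVStr σ) λ v → IsChild u a v
        from-first (m , u<m , m≤y , Vv , first) =
          take m y , first-V-below⇒Edge u y m u≼y u<m m≤y Vu Vv first , _ , str-first-V-below u y m u≼y u<m m≤y a head

  module EdgeStep {u v : PVStr σ} {a : PVSym σ} (ch : IsChild u a v) (p : PVStr σ) where
    open EdgeFacts (proj₁ ch) public

    P : PVStr σ
    P = a ∷ p

    l : ℕ
    l = ell u v P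

    l≡ : l ≡ length P ⊓ length α
    l≡ = cong (length P ⊓_) (sym (length-drop (length u) v))

    l≤P : l ≤ length P
    l≤P = subst (_≤ length P) (sym l≡) (m⊓n≤m _ _)

    l≤α : l ≤ length α
    l≤α = subst (_≤ length α) (sym l≡) (m⊓n≤n _ _)

    head-match : take 1 P ≡ take 1 α
    head-match = cong (take 1) (sym (proj₂ (proj₂ ch)))

    1≤α : 1 ≤ length α
    1≤α = subst (λ z → 1 ≤ length z) (sym (proj₂ (proj₂ ch))) (s≤s z≤n)

    module Update (nz : u ≢ []) =
      ReUpdate (length u) α (label-bounded u α PrevSub-u++α) (label-self-reference-unique u α PrevSub-u++α nz) P

    PrevSub-sl-u++α′-take : u ≢ [] → PrevSub (sl u ++ take l (angleGo 1 (length u) α))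
    PrevSub-sl-u++α′-take nz = PrevSub-++-take (sl u) _ l (PrevSub-sl-u++α′ nz)

  Run-sound : ∀ {p u x} → Run p u (just x) → V u → PrevSub (u ++ p)
  Run-sound {u = u} r-empty Vu = subst PrevSub (sym (++-identityʳ u)) (V⇒PrevSub Vu)
  Run-sound {a ∷ p} {u} (r-short ch l<2 run) _ =
    PrevSub-across-edge u α P l l≡ (short l<2 head-match) (subst (λ z → PrevSub (z ++ drop l P)) v≡u++α (Run-sound run V-v))
    where
    open EdgeStep ch p
    short : ∀ {k x y} → k < 2 → take 1 x ≡ take 1 y → take k x ≡ take k y
    short {zero} _ _ = refl
    short {suc zero} _ e = e
    short {suc (suc _)} (s≤s (s≤s ())) _
  Run-sound {a ∷ p} {u} (r-bad-ok ch _ _ match run) _ =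
    PrevSub-across-edge u α P l l≡ match (subst (λ z → PrevSub (z ++ drop l P)) v≡u++α (Run-sound run V-v))
    where open EdgeStep ch p
  Run-sound {a ∷ p} {u} (r-sl-ok {v = v} ch _ (gu , _) ok run₁ run₂) _ =
    PrevSub-across-edge u α P l l≡ match
      (subst (λ z → PrevSub (z ++ drop l P)) v≡u++α
        (subst (λ z → PrevSub (v ++ z)) (drop-update l l≡ (Re u v) view) (Run-sound run₂ V-v)))
    where
    open EdgeStep ch p
    nz = proj₁ gu
    open Update nz
    view = Re-view T u v
    angle-match : take l (update (Re u v)) ≡ take l α′
    angle-match =
      unary-path-determined l (sl u) (update (Re u v)) α′
        (subst (l ≤_) (sym (length-update (Re u v))) l≤P) (subst (l ≤_) (sym (length-angleGo 1 (length u) α)) l≤α)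
        (λ k h₁ h₂ → sl-interior-unary nz k h₁ (≤-trans h₂ l≤α))
        (Run-sound run₁ (proj₂ gu)) (PrevSub-sl-u++α′-take nz)
        (match⇒angle-match 1 (s≤s z≤n) 1≤α (Re u v) view head-match)
    match : take l P ≡ take l α
    match = angle-match⇒match l l≤P l≤α (Re u v) view angle-match ok

  PrevSub-length : ∀ {x} → PrevSub x → length x ≤ length T
  PrevSub-length {x} (w , (a , b , eT) , ep) = begin
    length x           ≡⟨ cong length (sym ep) ⟩
    length (pre w)     ≡⟨ length-preGo [] w ⟩
    length w           ≤⟨ List.length-++-≤ˡ w ⟩
    length (w ++ b)    ≤⟨ List.length-++-≤ʳ (w ++ b) {a} ⟩
    length (a ++ w ++ b) ≡⟨ cong length (sym eT) ⟩
    length T           ∎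
    where open ≤-Reasoning

  -- Each recursive call of P-Match either consumes pattern symbols or moves to a shorter node.
  measure : PVStr σ → PVStr σ → ℕ
  measure p u = length p * suc (length T) + length u

  measure-<-pattern : ∀ (p′ p u v : PVStr σ) → length p′ < length p → length v ≤ length T → measure p′ v < measure p u
  measure-<-pattern p′ p u v p′<p v≤T = begin-strict
    length p′ * N + length v ≤⟨ +-monoʳ-≤ (length p′ * N) v≤T ⟩
    length p′ * N + length T <⟨ +-monoʳ-< (length p′ * N) ≤-refl ⟩
    length p′ * N + N        ≡⟨ +-comm (length p′ * N) N ⟩
    suc (length p′) * N      ≤⟨ *-monoˡ-≤ N p′<p ⟩
    length p * N             ≤⟨ m≤m+n _ _ ⟩
    length p * N + length u  ∎
    where
    open ≤-Reasoning
    N = suc (length T)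

  measure-<-node : ∀ (p′ p u v : PVStr σ) → length p′ ≤ length p → length v < length u → measure p′ v < measure p u
  measure-<-node p′ p u v p′≤p v<u = +-mono-≤-< (*-monoˡ-≤ (suc (length T)) p′≤p) v<u

  length-sl : (u : PVStr σ) → u ≢ [] → length (sl u) < length u
  length-sl [] nz = ⊥-elim (nz refl)
  length-sl (c ∷ u) nz = s≤s (≤-reflexive (length-angleGo 1 1 u))

  module _ (suffix-leaf : ∀ i → i < length T → IsLeaf (pre (drop i T))) where

    CompleteBelow : ℕ → Set
    CompleteBelow f = ∀ p u → measure p u < f → V u → PrevSub (u ++ p) → Σ (PVStr σ) λ x → Run p u (just x)

    module CompletionStep (f : ℕ) (ih : CompleteBelow f) {u v : PVStr σ} {a : PVSym σ} (p : PVStr σ)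
      (μ≤f : measure (a ∷ p) u ≤ f) (ps : PrevSub (u ++ a ∷ p)) (ch : IsChild u a v) where
      open EdgeStep ch p

      match : take l P ≡ take l α
      match = unary-path-determined l u P α l≤P l≤α (λ k h₁ h₂ → interior-unary k h₁ (≤-trans h₂ l≤α))
                (PrevSub-++-take u P l ps) (PrevSub-++-take u α l PrevSub-u++α) head-match

      continue : Σ (PVStr σ) λ x → Run (drop l P) v (just x)
      continue = ih (drop l P) v (≤-trans (measure-<-pattern (drop l P) P u v drop<P (PrevSub-length (V⇒PrevSub V-v))) μ≤f) V-v
                   (subst (λ z → PrevSub (z ++ drop l P)) (sym v≡u++α) (PrevSub-beyond-edge u α P l l≡ match PrevSub-u++α ps))
        where
        1≤l : 1 ≤ l
        1≤l = subst (1 ≤_) (sym l≡) (⊓-glb (s≤s z≤n) 1≤α)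
        drop<P : length (drop l P) < length P
        drop<P = subst (_< length P) (sym (length-drop l P)) (∸-monoʳ-< {length P} {l} {0} 1≤l l≤P)

      module _ (gu : Good u) where
        nz = proj₁ gu
        open Update nz
        view = Re-view T u v

        suffix-link-call : Σ (PVStr σ) λ x → Run (take l (update (Re u v))) (sl u) (just x)
        suffix-link-call =
          ih (take l (update (Re u v))) (sl u)
            (≤-trans (measure-<-node (take l (update (Re u v))) P u (sl u) take≤P (length-sl u nz)) μ≤f) (proj₂ gu)
            (subst (λ z → PrevSub (sl u ++ z)) (sym (match⇒angle-match l l≤P l≤α (Re u v) view match)) (PrevSub-sl-u++α′-take nz))
          where
          take≤P : length (take l (update (Re u v))) ≤ length P
          take≤P = subst (_≤ length P) (sym (length-take l (update (Re u v))))
                     (≤-trans (m⊓n≤n l _) (≤-reflexive (length-update (Re u v))))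

        continue-updated : Σ (PVStr σ) λ x → Run (drop l (update (Re u v))) v (just x)
        continue-updated = subst (λ z → Σ (PVStr σ) λ x → Run z v (just x)) (sym (drop-update l l≡ (Re u v) view)) continue

      run : Dec (l < 2) → Dec (Good u) → Dec (Good v) → Σ (PVStr σ) λ x → Run P u (just x)
      run (yes l<2) _ _ = proj₁ continue , r-short ch l<2 (proj₂ continue)
      run (no l≮2) (no ¬gu) _ = proj₁ continue , r-bad-ok ch (≮⇒≥ l≮2) (λ g → ¬gu (proj₁ g)) match (proj₂ continue)
      run (no l≮2) (yes _) (no ¬gv) = proj₁ continue , r-bad-ok ch (≮⇒≥ l≮2) (λ g → ¬gv (proj₂ g)) match (proj₂ continue)
      run (no l≮2) (yes gu) (yes gv) =
        proj₁ (continue-updated gu) ,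
        r-sl-ok ch (≮⇒≥ l≮2) (gu , gv) (match⇒CheckOK l l≡ (Re u v) (view gu) match)
          (proj₂ (suffix-link-call gu)) (proj₂ (continue-updated gu))
        where open Update (proj₁ gu)

    Run-complete-below : ∀ f → CompleteBelow f
    Run-complete-below f [] u _ _ _ = u , r-empty
    Run-complete-below (suc f) (a ∷ p) u (s≤s μ≤f) Vu ps =
      let (v , ch) = child-exists suffix-leaf u a p Vu ps
      in CompletionStep.run f (Run-complete-below f) p μ≤f ps ch (ell u v (a ∷ p) <? 2) (Good? u) (Good? v)

    Run-complete : ∀ p → PrevSub p → Σ (PVStr σ) λ x → Run p [] (just x)
    Run-complete p ps = Run-complete-below (suc (measure p [])) p [] ≤-refl V-[] ps

proposition1 : ∀ {σ π : ℕ} (T₀ : List (Sym σ π)) (d : Fin σ) →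
    inj₁ d ∉ T₀ → (P : List (Sym σ π)) →
    (Σ (List (Sym σ π)) λ w → IsSubstring w (T₀ ++ (inj₁ d ∷ [])) × PMatches w P)
      ⇔ (Σ (PVStr σ) λ v → PLST.Run (T₀ ++ (inj₁ d ∷ [])) (pre P) [] (just v))
proposition1 T₀ d d∉T₀ P = mk⇔ match⇒run run⇒match
  where
  T = T₀ ++ inj₁ d ∷ []
  match⇒run : (Σ (List _) λ w → IsSubstring w T × PMatches w P) → Σ (PVStr _) λ v → PLST.Run T (pre P) [] (just v)
  match⇒run (w , w⊑T , w≈P) =
    Run-complete T (sentinel-suffix-leaf T₀ d d∉T₀) (pre P) (w , w⊑T , PMatches⇒pre≡ w P w≈P)
  run⇒match : (Σ (PVStr _) λ v → PLST.Run T (pre P) [] (just v)) → Σ (List _) λ w → IsSubstring w T × PMatches w P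
  run⇒match (_ , run) with Run-sound T run (V-[] T)
  ... | w , w⊑T , pre-w≡pre-P = w , w⊑T , pre≡⇒PMatches w P pre-w≡pre-P
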